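{- Let $G=(V,E)$ be a connected digraph. Then the facets of $\tilde{\mathcal Q}_G$ are described as follows: (1) $C^*\mapsto\{\mathbf x\in\tilde{\mathcal Q}_G\mid f_{C^*}(\mathbf x)=0\}$ is a bijection between the elementary directed cuts of $G$ and the facets of $\tilde{\mathcal Q}_G$ containing $\mathbf 0$; (2) $\ell\mapsto\{\mathbf x\in\tilde{\mathcal Q}_G\mid \ell\cdot\mathbf x=1\}$ induces a bijection between equivalence classes of admissible layerings (where $\ell\sim\ell+m\mathbf 1$ for $m\in\mathbb Z$) and the facets of $\tilde{\mathcal Q}_G$ not containing $\mathbf 0$.
   Context: For an edge $e=\overrightarrow{th}$, $\mathbf x_e=\mathbf 1_h-\mathbf 1_t$; $\tilde{\mathcal Q}_G=\mathrm{conv}(\{\mathbf 0\}\cup\{\mathbf x_e\mid e\in E\})$; $\mathbf 1=\sum_v\mathbf 1_v$. A cut is a nonempty edge set consisting of the edges between $V_0$ and $V_1$ for a partition $V=V_0\sqcup V_1$; elementary means inclusion-minimal among cuts; directed means all its edges point to the same shore, which we call $V_1$. $f_{C^*}$ is the linear functional with $f_{C^*}(\mathbf 1_v)=1$ for $v\in V_1$ and $0$ for $v\in V_0$. An admissible layering is $\ell:V\to\mathbb Z$ (viewed as a vector) with $\ell(h)-\ell(t)\le1$ for each edge $\overrightarrow{th}$, such that the edges with equality form a weakly connected spanning subgraph of $G$.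
   Formalization: The polytope $\tilde{\mathcal Q}_G$ is taken over ℚ: its points, faces and facets have rational coordinates, and the linear functionals cutting out faces have rational coefficients. -}

module Defs where

open import Data.Nat as ℕ using (ℕ; zero; suc)
open import Data.Integer as ℤ using (ℤ)
open import Data.Rational as ℚ using (ℚ; 0ℚ; 1ℚ; _/_)
open import Data.Fin using (Fin; zero; suc; _≟_)
open import Data.Bool using (Bool; true; false; if_then_else_; _xor_)
open import Data.Product using (Σ; ∃; _×_; _,_)
open import Data.Unit using (⊤)
open import Relation.Nullary using (¬_; does)
open import Relation.Binary.PropositionalEquality using (_≡_)

∑ : ∀ {k} → (Fin k → ℚ) → ℚ
∑ {zero}  f = 0ℚ
∑ {suc k} f = f zero ℚ.+ ∑ (λ i → f (suc i))

Point : ℕ → Set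
Point n = Fin n → ℚ

origin : ∀ {n} → Point n
origin _ = 0ℚ

dot : ∀ {n} → Point n → Point n → ℚ
dot a x = ∑ (λ i → a i ℚ.* x i)

unit : ∀ {n} → Fin n → Point n
unit v i = if does (i ≟ v) then 1ℚ else 0ℚ

toℚ : ∀ {n} → (Fin n → ℤ) → Point n
toℚ ℓ i = ℓ i / 1

PSet : ℕ → Set₁
PSet n = Point n → Set

_≐_ : ∀ {n} → PSet n → PSet n → Set
F ≐ G = ∀ x → (F x → G x) × (G x → F x)

Conv : ∀ {n k} → (Fin k → Point n) → PSet n
Conv {n} {k} S x =
  Σ (Fin k → ℚ) λ c →
    (∀ i → 0ℚ ℚ.≤ c i) × (∑ c ≡ 1ℚ) × (∀ j → x j ≡ ∑ (λ i → c i ℚ.* S i j))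

IsFace : ∀ {n} → PSet n → PSet n → Set
IsFace {n} P F =
  Σ (Point n) λ a → Σ ℚ λ b →
    (∀ x → P x → dot a x ℚ.≤ b) × (F ≐ (λ x → P x × (dot a x ≡ b)))

AffIndep : ∀ {n k} → (Fin k → Point n) → Set
AffIndep {n} {k} p =
  (c : Fin k → ℚ) → ∑ c ≡ 0ℚ → (∀ j → ∑ (λ i → c i ℚ.* p i j) ≡ 0ℚ) → ∀ i → c i ≡ 0ℚ

-- HasRank F r : the maximal number of affinely independent points of F is r,
-- i.e. dim F = r - 1 (the empty set has rank 0, i.e. dimension -1)
HasRank : ∀ {n} → PSet n → ℕ → Set
HasRank {n} F r =
  (Σ (Fin r → Point n) λ p → (∀ i → F (p i)) × AffIndep p)
  × ((p : Fin (suc r) → Point n) → (∀ i → F (p i)) → ¬ AffIndep p)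

IsFacet : ∀ {n} → PSet n → PSet n → Set
IsFacet P F = IsFace P F × ∃ λ r → HasRank P (suc r) × HasRank F r

-- Digraphs: vertices Fin n, edges Fin m, edge e goes from tl e to hd e
-- (loops and multiple edges allowed)

module Graph {n m : ℕ} (tl hd : Fin m → Fin n) where

  data Reach (R : Fin m → Set) (u : Fin n) : Fin n → Set where
    here : Reach R u u
    fwd  : ∀ {e} → R e → Reach R u (tl e) → Reach R u (hd e)
    bwd  : ∀ {e} → R e → Reach R u (hd e) → Reach R u (tl e)

  SpanConnected : (Fin m → Set) → Set
  SpanConnected R = ∀ u v → Reach R u v

  Connected : Set
  Connected = (1 ℕ.≤ n) × SpanConnected (λ _ → ⊤)

  xe : Fin m → Point n
  xe e i = unit (hd e) i ℚ.- unit (tl e) i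

  gens : Fin (suc m) → Point n
  gens zero    = origin
  gens (suc e) = xe e

  Q : PSet n
  Q = Conv gens

  EdgeSet : Set
  EdgeSet = Fin m → Bool

  -- edges between the two shores of the partition p (p v = true ⇔ v ∈ V₁)
  cutOf : (Fin n → Bool) → EdgeSet
  cutOf p e = p (tl e) xor p (hd e)

  IsCut : EdgeSet → Set
  IsCut C = (∃ λ p → ∀ e → C e ≡ cutOf p e) × (∃ λ e → C e ≡ true)

  _⊆ₑ_ : EdgeSet → EdgeSet → Set
  C ⊆ₑ D = ∀ e → C e ≡ true → D e ≡ true

  _≡ₑ_ : EdgeSet → EdgeSet → Set
  C ≡ₑ D = ∀ e → C e ≡ D e

  Elementary : EdgeSet → Set
  Elementary C = IsCut C × (∀ D → IsCut D → D ⊆ₑ C → D ≡ₑ C)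

  DirectedShore : EdgeSet → (Fin n → Bool) → Set
  DirectedShore C p = (C ≡ₑ cutOf p) × (∀ e → C e ≡ true → p (hd e) ≡ true)

  -- f_{C*} for a directed cut with head shore V₁ = p
  fvec : (Fin n → Bool) → Point n
  fvec p v = if p v then 1ℚ else 0ℚ

  cutFace : (Fin n → Bool) → PSet n
  cutFace p x = Q x × (dot (fvec p) x ≡ 0ℚ)

  Tight : (Fin n → ℤ) → Fin m → Set
  Tight ℓ e = ℓ (hd e) ≡ ℓ (tl e) ℤ.+ ℤ.+ 1

  Admissible : (Fin n → ℤ) → Set
  Admissible ℓ = (∀ e → ℓ (hd e) ℤ.- ℓ (tl e) ℤ.≤ ℤ.+ 1) × SpanConnected (Tight ℓ)

  layerFace : (Fin n → ℤ) → PSet n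
  layerFace ℓ x = Q x × (dot (toℚ ℓ) x ≡ 1ℚ)

module Submission where

-- Q̃_G lies in the hyperplane 𝟏 · x = 0, and the origin together with the edge vectors of a
-- spanning tree shows that it has dimension n − 1 there. A facet F = Q̃_G ∩ {a · x = b} is the
-- convex hull of the generators it contains, so a(h) − a(t) = b along the edges with x_e ∈ F.
-- Counting dimensions with indicator functionals of vertex sets: if b ≠ 0 these edges connect G,
-- so a = a(0)𝟏 + b ℓ for an admissible layering ℓ; if b = 0 they form exactly two components, on
-- which a takes two values, and the edges between them form an elementary directed cut.
-- Conversely, spanning forests of the tight edges, resp. of the two shores of a cut, show that
-- the layering and cut faces have dimension n − 2.

open import Defs

module Proof where

  open import Data.Nat as ℕ using (ℕ; zero; suc; z≤n; s≤s)
  import Data.Nat.Properties as ℕP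
  open import Data.Integer as ℤ using (ℤ)
  import Data.Integer.Properties as ℤP
  import Data.Integer.Solver
  open import Data.Rational as ℚ using (ℚ; 0ℚ; 1ℚ; _+_; _*_; -_; _-_; _≤_; _<_)
  import Data.Rational.Properties as ℚP
  open import Data.Rational.Solver using (module +-*-Solver)
  open import Data.Rational.Unnormalised as ℚᵘ using (mkℚᵘ; *≡*; *≤*)
  import Data.Rational.Unnormalised.Properties as ℚᵘP
  open import Data.Fin as Fin using (Fin; zero; suc; punchIn; punchOut)
  open import Data.Fin.Properties using (all?; any?; ¬∀⟶∃¬; punchIn-punchOut; suc-injective)
  open import Data.Bool using (Bool; true; false; if_then_else_; not; _xor_)
  import Data.Bool.Properties as BoolP
  open import Data.Product using (Σ; ∃; _×_; _,_; proj₁; proj₂)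
  open import Data.Sum using (_⊎_; inj₁; inj₂; [_,_]′)
  open import Data.Empty using (⊥; ⊥-elim)
  open import Data.Unit using (⊤; tt)
  open import Function using (id; _∘_; _⇔_; mk⇔; Equivalence)
  open import Data.List as List using (List; []; _∷_)
  open import Data.List.Membership.Propositional using (_∈_; _∉_)
  open import Data.List.Membership.Propositional.Properties using (∈-map⁺)
  open import Data.List.Relation.Unary.Any as Any using (here; there)
  open import Data.List.Relation.Binary.Subset.Propositional using (_⊆_)
  import Data.Vec.Functional as Vec
  open import Data.Vec.Functional.Properties using (updateAt-updates; updateAt-minimal)
  open import Relation.Nullary using (¬_; Dec; yes; no; does; contradiction; ¬?; _×-dec_)
  open import Relation.Nullary.Decidable using (decidable-stable)
  open import Relation.Binary.PropositionalEquality
  open import Relation.Binary.Definitions using (tri<; tri≈; tri>)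
  open import Algebra.Properties.CommutativeMonoid.Sum ℚP.+-0-commutativeMonoid
    using (sum; ∑-distrib-+; ∑-comm)
  open import Algebra.Properties.Group ℚP.+-0-group using (x∙y⁻¹≈ε⇒x≈y)
  open ≡-Reasoning

  private
    module S = +-*-Solver
    module Z = Data.Integer.Solver.+-*-Solver

  *-cancel-≢0 : ∀ {p q} → p ≢ 0ℚ → p * q ≡ 0ℚ → q ≡ 0ℚ
  *-cancel-≢0 {p} {q} p≢0 pq≡0 = begin
    q                  ≡⟨ sym (ℚP.*-identityˡ q) ⟩
    1ℚ * q             ≡⟨ cong (_* q) (sym (ℚP.*-inverseˡ p)) ⟩
    (ℚ.1/ p) * p * q   ≡⟨ ℚP.*-assoc (ℚ.1/ p) p q ⟩
    (ℚ.1/ p) * (p * q) ≡⟨ cong ((ℚ.1/ p) *_) pq≡0 ⟩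
    (ℚ.1/ p) * 0ℚ      ≡⟨ ℚP.*-zeroʳ (ℚ.1/ p) ⟩
    0ℚ                 ∎
    where instance _ = ℚ.≢-nonZero p≢0

  1≢0 : 1ℚ ≢ 0ℚ
  1≢0 ()

  p-q≡0⇒p≡q : ∀ {p q} → p - q ≡ 0ℚ → p ≡ q
  p-q≡0⇒p≡q {p} {q} = x∙y⁻¹≈ε⇒x≈y p q

  p-q≤0⇒p≤q : ∀ {p q} → p - q ≤ 0ℚ → p ≤ q
  p-q≤0⇒p≤q {p} {q} p-q≤0 = ℚP.≤-trans (ℚP.≤-reflexive (S.solve 2 (λ p q → p S.:= (p S.:- q) S.:+ q) refl p q))
    (ℚP.≤-trans (ℚP.+-monoˡ-≤ q p-q≤0) (ℚP.≤-reflexive (ℚP.+-identityˡ q)))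

  p≤q⇒0≤q-p : ∀ {p q} → p ≤ q → 0ℚ ≤ q - p
  p≤q⇒0≤q-p {p} le = ℚP.≤-trans (ℚP.≤-reflexive (sym (ℚP.+-inverseʳ p))) (ℚP.+-monoˡ-≤ (- p) le)

  0≤p→0≤q→p+q≡0⇒p≡0 : ∀ {p q} → 0ℚ ≤ p → 0ℚ ≤ q → p + q ≡ 0ℚ → p ≡ 0ℚ
  0≤p→0≤q→p+q≡0⇒p≡0 {p} {q} 0≤p 0≤q p+q≡0 = ℚP.≤-antisym p≤0 0≤p
    where
    p≤0 : p ≤ 0ℚ
    p≤0 = ℚP.≤-trans (ℚP.≤-reflexive (sym (ℚP.+-identityʳ p)))
            (ℚP.≤-trans (ℚP.+-monoʳ-≤ p 0≤q) (ℚP.≤-reflexive p+q≡0))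

  ∑≡sum : ∀ {k} (f : Fin k → ℚ) → ∑ f ≡ sum f
  ∑≡sum {zero}  f = refl
  ∑≡sum {suc k} f = cong (f zero +_) (∑≡sum (λ i → f (suc i)))

  ∑-cong : ∀ {k} {f g : Fin k → ℚ} → (∀ i → f i ≡ g i) → ∑ f ≡ ∑ g
  ∑-cong {zero}  f≗g = refl
  ∑-cong {suc k} f≗g = cong₂ _+_ (f≗g zero) (∑-cong (λ i → f≗g (suc i)))

  ∑-zero : ∀ {k} {f : Fin k → ℚ} → (∀ i → f i ≡ 0ℚ) → ∑ f ≡ 0ℚ
  ∑-zero {zero}  f≗0 = refl
  ∑-zero {suc k} f≗0 = cong₂ _+_ (f≗0 zero) (∑-zero (λ i → f≗0 (suc i)))

  ∑-+ : ∀ {k} (f g : Fin k → ℚ) → ∑ (λ i → f i + g i) ≡ ∑ f + ∑ g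
  ∑-+ f g = begin
    ∑ (λ i → f i + g i)   ≡⟨ ∑≡sum (λ i → f i + g i) ⟩
    sum (λ i → f i + g i) ≡⟨ ∑-distrib-+ f g ⟩
    sum f + sum g         ≡⟨ sym (cong₂ _+_ (∑≡sum f) (∑≡sum g)) ⟩
    ∑ f + ∑ g             ∎

  ∑-swap : ∀ {k l} (f : Fin k → Fin l → ℚ) → ∑ (λ i → ∑ (f i)) ≡ ∑ (λ j → ∑ (λ i → f i j))
  ∑-swap f = begin
    ∑ (λ i → ∑ (f i))             ≡⟨ trans (∑-cong (λ i → ∑≡sum (f i))) (∑≡sum (λ i → sum (f i))) ⟩
    sum (λ i → sum (f i))         ≡⟨ ∑-comm f ⟩
    sum (λ j → sum (λ i → f i j)) ≡⟨ sym (trans (∑-cong (λ j → ∑≡sum (λ i → f i j)))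
                                               (∑≡sum (λ j → sum (λ i → f i j)))) ⟩
    ∑ (λ j → ∑ (λ i → f i j))     ∎

  *-distribˡ-∑ : ∀ {k} (a : ℚ) (f : Fin k → ℚ) → a * ∑ f ≡ ∑ (λ i → a * f i)
  *-distribˡ-∑ {zero}  a f = ℚP.*-zeroʳ a
  *-distribˡ-∑ {suc k} a f = trans (ℚP.*-distribˡ-+ a (f zero) _) (cong (a * f zero +_) (*-distribˡ-∑ a (λ i → f (suc i))))

  *-distribʳ-∑ : ∀ {k} (a : ℚ) (f : Fin k → ℚ) → ∑ f * a ≡ ∑ (λ i → f i * a)
  *-distribʳ-∑ a f = trans (ℚP.*-comm (∑ f) a) (trans (*-distribˡ-∑ a f) (∑-cong (λ i → ℚP.*-comm a (f i))))

  ∑-neg : ∀ {k} (f : Fin k → ℚ) → ∑ (λ i → - f i) ≡ - ∑ f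
  ∑-neg {zero}  f = refl
  ∑-neg {suc k} f = trans (cong (- f zero +_) (∑-neg (λ i → f (suc i)))) (sym (ℚP.neg-distrib-+ (f zero) _))

  ∑-- : ∀ {k} (f g : Fin k → ℚ) → ∑ (λ i → f i - g i) ≡ ∑ f - ∑ g
  ∑-- f g = trans (∑-+ f (λ i → - g i)) (cong (∑ f +_) (∑-neg g))

  ∑-mono-≤ : ∀ {k} {f g : Fin k → ℚ} → (∀ i → f i ≤ g i) → ∑ f ≤ ∑ g
  ∑-mono-≤ {zero}  f≤g = ℚP.≤-refl
  ∑-mono-≤ {suc k} f≤g = ℚP.+-mono-≤ (f≤g zero) (∑-mono-≤ (λ i → f≤g (suc i)))

  ∑-nonneg : ∀ {k} {f : Fin k → ℚ} → (∀ i → 0ℚ ≤ f i) → 0ℚ ≤ ∑ f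
  ∑-nonneg {k} 0≤f = ℚP.≤-trans (ℚP.≤-reflexive (sym (∑-zero {k} (λ _ → refl)))) (∑-mono-≤ 0≤f)

  ∑-nonneg≡0 : ∀ {k} {f : Fin k → ℚ} → (∀ i → 0ℚ ≤ f i) → ∑ f ≡ 0ℚ → ∀ i → f i ≡ 0ℚ
  ∑-nonneg≡0 {suc k} 0≤f ∑≡0 zero = 0≤p→0≤q→p+q≡0⇒p≡0 (0≤f zero) (∑-nonneg (λ i → 0≤f (suc i))) ∑≡0
  ∑-nonneg≡0 {suc k} {f} 0≤f ∑≡0 (suc i) = ∑-nonneg≡0 (λ i → 0≤f (suc i)) tail≡0 i
    where
    tail≡0 = 0≤p→0≤q→p+q≡0⇒p≡0 (∑-nonneg (λ i → 0≤f (suc i))) (0≤f zero)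
               (trans (ℚP.+-comm _ (f zero)) ∑≡0)

  ∑-single : ∀ {k} (f : Fin k → ℚ) (u : Fin k) → (∀ i → i ≢ u → f i ≡ 0ℚ) → ∑ f ≡ f u
  ∑-single {suc k} f zero    f≗0 =
    trans (cong (f zero +_) (∑-zero (λ i → f≗0 (suc i) λ ()))) (ℚP.+-identityʳ (f zero))
  ∑-single {suc k} f (suc u) f≗0 =
    trans (cong₂ _+_ (f≗0 zero λ ()) (∑-single (λ i → f (suc i)) u (λ i i≢u → f≗0 (suc i) (i≢u ∘ suc-injective))))
          (ℚP.+-identityˡ (f (suc u)))

  unit-same : ∀ {n} (v : Fin n) → unit v v ≡ 1ℚ
  unit-same zero    = refl
  unit-same (suc v) = unit-same v

  unit-other : ∀ {n} (v i : Fin n) → i ≢ v → unit v i ≡ 0ℚ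
  unit-other v i i≢v with i Fin.≟ v
  ... | yes i≡v = contradiction i≡v i≢v
  ... | no  _   = refl

  unit-nonneg : ∀ {n} (v i : Fin n) → 0ℚ ≤ unit v i
  unit-nonneg v i with does (i Fin.≟ v)
  ... | true  = ℚP.≤ᵇ⇒≤ tt
  ... | false = ℚP.≤-refl

  dot-unitˡ : ∀ {n} (v : Fin n) (x : Point n) → dot (unit v) x ≡ x v
  dot-unitˡ v x = begin
    ∑ (λ i → unit v i * x i) ≡⟨ ∑-single _ v (λ i i≢v → trans (cong (_* x i) (unit-other v i i≢v)) (ℚP.*-zeroˡ (x i))) ⟩
    unit v v * x v           ≡⟨ cong (_* x v) (unit-same v) ⟩
    1ℚ * x v                 ≡⟨ ℚP.*-identityˡ (x v) ⟩
    x v                      ∎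

  dot-comm : ∀ {n} (a x : Point n) → dot a x ≡ dot x a
  dot-comm a x = ∑-cong (λ i → ℚP.*-comm (a i) (x i))

  dot-unitʳ : ∀ {n} (a : Point n) (v : Fin n) → dot a (unit v) ≡ a v
  dot-unitʳ a v = trans (dot-comm a (unit v)) (dot-unitˡ v a)

  ∑-unit : ∀ {n} (v : Fin n) → ∑ (unit v) ≡ 1ℚ
  ∑-unit v = trans (∑-cong (λ i → sym (ℚP.*-identityʳ (unit v i)))) (dot-unitˡ v (λ _ → 1ℚ))

  dot-congˡ : ∀ {n} {a b : Point n} (x : Point n) → (∀ v → a v ≡ b v) → dot a x ≡ dot b x
  dot-congˡ x a≗b = ∑-cong (λ v → cong (_* x v) (a≗b v))

  dot-congʳ : ∀ {n} (a : Point n) {x y : Point n} → (∀ v → x v ≡ y v) → dot a x ≡ dot a y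
  dot-congʳ a x≗y = ∑-cong (λ v → cong (a v *_) (x≗y v))

  dot-zeroʳ : ∀ {n} (a : Point n) {x : Point n} → (∀ v → x v ≡ 0ℚ) → dot a x ≡ 0ℚ
  dot-zeroʳ a x≗0 = ∑-zero (λ v → trans (cong (a v *_) (x≗0 v)) (ℚP.*-zeroʳ (a v)))

  dot-origin : ∀ {n} (a : Point n) → dot a origin ≡ 0ℚ
  dot-origin a = dot-zeroʳ a (λ _ → refl)

  dot-negˡ : ∀ {n} (a x : Point n) → dot (λ v → - a v) x ≡ - dot a x
  dot-negˡ a x = trans (∑-cong (λ v → sym (ℚP.neg-distribˡ-* (a v) (x v)))) (∑-neg (λ v → a v * x v))

  dot-linearˡ : ∀ {n} (α β : ℚ) (a b x : Point n) →
                dot (λ v → α * a v + β * b v) x ≡ α * dot a x + β * dot b x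
  dot-linearˡ α β a b x = begin
    ∑ (λ v → (α * a v + β * b v) * x v)
      ≡⟨ ∑-cong (λ v → S.solve 5 (λ α β a b x → (α S.:* a S.:+ β S.:* b) S.:* x S.:= α S.:* (a S.:* x) S.:+ β S.:* (b S.:* x))
                                  refl α β (a v) (b v) (x v)) ⟩
    ∑ (λ v → α * (a v * x v) + β * (b v * x v))
      ≡⟨ ∑-+ (λ v → α * (a v * x v)) (λ v → β * (b v * x v)) ⟩
    ∑ (λ v → α * (a v * x v)) + ∑ (λ v → β * (b v * x v))
      ≡⟨ sym (cong₂ _+_ (*-distribˡ-∑ α (λ v → a v * x v)) (*-distribˡ-∑ β (λ v → b v * x v))) ⟩
    α * dot a x + β * dot b x ∎

  isolate-coordinate : ∀ {n} (g y : Point n) (u : Fin n) → dot g y ≡ 0ℚ → g u ≡ 1ℚ →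
                       (∀ v → v ≢ u → g v ≡ 0ℚ ⊎ y v ≡ 0ℚ) → y u ≡ 0ℚ
  isolate-coordinate g y u g·y≡0 gu≡1 others = begin
    y u        ≡⟨ sym (ℚP.*-identityˡ (y u)) ⟩
    1ℚ * y u   ≡⟨ cong (_* y u) (sym gu≡1) ⟩
    g u * y u  ≡⟨ sym (∑-single (λ v → g v * y v) u term≡0) ⟩
    dot g y    ≡⟨ g·y≡0 ⟩
    0ℚ         ∎
    where
    term≡0 : ∀ v → v ≢ u → g v * y v ≡ 0ℚ
    term≡0 v v≢u with others v v≢u
    ... | inj₁ gv≡0 = trans (cong (_* y v) gv≡0) (ℚP.*-zeroˡ (y v))
    ... | inj₂ yv≡0 = trans (cong (g v *_) yv≡0) (ℚP.*-zeroʳ (g v))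

  lincomb : ∀ {n k} → (Fin k → ℚ) → (Fin k → Point n) → Point n
  lincomb c p v = ∑ (λ i → c i * p i v)

  dot-lincomb : ∀ {n k} (a : Point n) (c : Fin k → ℚ) (p : Fin k → Point n) →
                dot a (lincomb c p) ≡ ∑ (λ i → c i * dot a (p i))
  dot-lincomb a c p = begin
    ∑ (λ v → a v * ∑ (λ i → c i * p i v))   ≡⟨ ∑-cong (λ v → *-distribˡ-∑ (a v) (λ i → c i * p i v)) ⟩
    ∑ (λ v → ∑ (λ i → a v * (c i * p i v))) ≡⟨ ∑-swap (λ v i → a v * (c i * p i v)) ⟩
    ∑ (λ i → ∑ (λ v → a v * (c i * p i v))) ≡⟨ ∑-cong (λ i → trans (∑-cong (λ v → swap (a v) (c i) (p i v)))
                                                                  (sym (*-distribˡ-∑ (c i) (λ v → a v * p i v)))) ⟩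
    ∑ (λ i → c i * dot a (p i))             ∎
    where
    swap : ∀ a c p → a * (c * p) ≡ c * (a * p)
    swap = S.solve 3 (λ a c p → a S.:* (c S.:* p) S.:= c S.:* (a S.:* p)) refl

  dot-lincomb-zero : ∀ {n k} (a : Point n) (c : Fin k → ℚ) (p : Fin k → Point n) →
                     (∀ i → dot a (p i) ≡ 0ℚ) → dot a (lincomb c p) ≡ 0ℚ
  dot-lincomb-zero a c p a·p≡0 =
    trans (dot-lincomb a c p) (∑-zero (λ i → trans (cong (c i *_) (a·p≡0 i)) (ℚP.*-zeroʳ (c i))))

  -- Homogeneous linear systems with more unknowns than equations

  NonTrivial : ∀ {k} → (Fin k → ℚ) → Set
  NonTrivial c = ∃ λ i → c i ≢ 0ℚ

  Solution : ∀ {r k} → (Fin r → Point k) → Set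
  Solution {k = k} M = Σ (Point k) λ c → NonTrivial c × (∀ t → dot c (M t) ≡ 0ℚ)

  *-≢0 : ∀ {p q} → p ≢ 0ℚ → q ≢ 0ℚ → p * q ≢ 0ℚ
  *-≢0 p≢0 q≢0 pq≡0 = q≢0 (*-cancel-≢0 p≢0 pq≡0)

  homogeneous-solution : ∀ k {r} → r ℕ.≤ k → (M : Fin r → Point (suc k)) → Solution M
  eliminate : ∀ k {r} → r ℕ.≤ suc k → (M : Fin r → Point (suc (suc k))) →
              (t₀ : Fin r) → M t₀ zero ≢ 0ℚ → Solution M

  homogeneous-solution zero    z≤n M = (λ _ → 1ℚ) , (zero , 1≢0) , λ ()
  homogeneous-solution (suc k) r≤k M with all? (λ t → M t zero ℚ.≟ 0ℚ)
  ... | yes column≡0 = unit zero , (zero , 1≢0) , λ t → trans (dot-unitˡ zero (M t)) (column≡0 t)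
  ... | no  column≢0 with ¬∀⟶∃¬ _ _ (λ t → M t zero ℚ.≟ 0ℚ) column≢0
  ...   | t₀ , pivot≢0 = eliminate k r≤k M t₀ pivot≢0

  -- Eliminate the first unknown with the pivot row t₀ and solve the reduced system recursively.
  eliminate k {suc r} (s≤s r≤k) M t₀ α≢0 = c , (suc i₀ , *-≢0 α≢0 c′i₀≢0) , row
    where
    α : ℚ
    α = M t₀ zero
    pivotTail : Point (suc k)
    pivotTail j = M t₀ (suc j)
    reduced : Fin r → Point (suc k)
    reduced t j = α * M (punchIn t₀ t) (suc j) + (- M (punchIn t₀ t) zero) * pivotTail j
    solution : Solution reduced
    solution = homogeneous-solution k r≤k reduced
    c′ : Point (suc k)
    c′ = proj₁ solution
    i₀ : Fin (suc k)
    i₀ = proj₁ (proj₁ (proj₂ solution))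
    c′i₀≢0 : c′ i₀ ≢ 0ℚ
    c′i₀≢0 = proj₂ (proj₁ (proj₂ solution))
    σ : ℚ
    σ = dot c′ pivotTail
    c : Point (suc (suc k))
    c = (- σ) Vec.∷ (λ j → α * c′ j)
    expand : ∀ s → dot c (M s) ≡ - σ * M s zero + α * dot c′ (λ j → M s (suc j))
    expand s = cong (- σ * M s zero +_)
      (trans (∑-cong (λ j → ℚP.*-assoc α (c′ j) (M s (suc j)))) (sym (*-distribˡ-∑ α (λ j → c′ j * M s (suc j)))))
    reduced-row : ∀ t → dot c (M (punchIn t₀ t)) ≡ 0ℚ
    reduced-row t = begin
      dot c (M s)
        ≡⟨ expand s ⟩
      - σ * β + α * dot c′ (λ j → M s (suc j))
        ≡⟨ rearrange σ β α (dot c′ (λ j → M s (suc j))) ⟩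
      α * dot c′ (λ j → M s (suc j)) + (- β) * σ
        ≡⟨ cong₂ (λ d e → α * d + (- β) * e) (dot-comm c′ (λ j → M s (suc j))) (dot-comm c′ pivotTail) ⟩
      α * dot (λ j → M s (suc j)) c′ + (- β) * dot pivotTail c′
        ≡⟨ sym (dot-linearˡ α (- β) (λ j → M s (suc j)) pivotTail c′) ⟩
      dot (reduced t) c′
        ≡⟨ dot-comm (reduced t) c′ ⟩
      dot c′ (reduced t)
        ≡⟨ proj₂ (proj₂ solution) t ⟩
      0ℚ ∎
      where
      rearrange : ∀ σ β α d → - σ * β + α * d ≡ α * d + (- β) * σ
      rearrange = S.solve 4 (λ σ β α d → (S.:- σ) S.:* β S.:+ α S.:* d S.:= α S.:* d S.:+ (S.:- β) S.:* σ) refl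
      s : Fin (suc r)
      s = punchIn t₀ t
      β : ℚ
      β = M s zero
    row : ∀ t → dot c (M t) ≡ 0ℚ
    row t with t₀ Fin.≟ t
    ... | yes refl = trans (expand t₀) (S.solve 2 (λ σ α → (S.:- σ) S.:* α S.:+ α S.:* σ S.:= S.con 0ℚ) refl σ α)
    ... | no t₀≢t  = subst (λ t → dot c (M t) ≡ 0ℚ) (punchIn-punchOut t₀≢t) (reduced-row (punchOut t₀≢t))

  affine-dependency : ∀ {n k r} (φ : Fin r → Point n) (p : Fin (suc k) → Point n) → suc r ℕ.≤ k →
                      Σ (Fin (suc k) → ℚ) λ c → NonTrivial c × ∑ c ≡ 0ℚ × (∀ t → dot (φ t) (lincomb c p) ≡ 0ℚ)
  affine-dependency φ p r<k with homogeneous-solution _ r<k ((λ _ → 1ℚ) Vec.∷ (λ t i → dot (φ t) (p i)))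
  ... | c , nontrivial , rows =
    c , nontrivial , trans (∑-cong (λ i → sym (ℚP.*-identityʳ (c i)))) (rows zero) ,
    λ t → trans (dot-lincomb (φ t) c p) (rows (suc t))

  VanishesOff : ∀ {n} → List (Fin n) → Point n → Set
  VanishesOff ws y = ∀ v → v ∉ ws → y v ≡ 0ℚ

  VanishesOff-⊆ : ∀ {n} {ws ws′ : List (Fin n)} {y : Point n} → ws ⊆ ws′ → VanishesOff ws y → VanishesOff ws′ y
  VanishesOff-⊆ ws⊆ws′ y-off v v∉ws′ = y-off v (v∉ws′ ∘ ws⊆ws′)

  VanishesOff-[] : ∀ {n} {y : Point n} → VanishesOff [] y → ∀ v → y v ≡ 0ℚ
  VanishesOff-[] y-off v = y-off v λ ()

  peel : ∀ {n} {u : Fin n} {ws} (g : Point n) {y : Point n} → VanishesOff (u ∷ ws) y →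
         dot g y ≡ 0ℚ → g u ≡ 1ℚ → (∀ {w} → w ∈ ws → g w ≡ 0ℚ) → VanishesOff ws y
  peel {u = u} {ws} g {y} y-off g·y≡0 gu≡1 g-ws v v∉ws with v Fin.≟ u
  ... | yes refl = isolate-coordinate g y u g·y≡0 gu≡1 others
    where
    others : ∀ v → v ≢ u → g v ≡ 0ℚ ⊎ y v ≡ 0ℚ
    others v v≢u with Any.any? (v Fin.≟_) ws
    ... | yes v∈ws = inj₁ (g-ws v∈ws)
    ... | no  v∉ws = inj₂ (y-off v λ { (here v≡u) → v≢u v≡u ; (there v∈ws) → v∉ws v∈ws })
  ... | no v≢u = y-off v λ { (here v≡u) → v≢u v≡u ; (there v∈ws) → v∉ws v∈ws }

  -- Fin r enumerates, possibly with repetitions, the coordinates outside ws.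
  record Complement {n} (ws : List (Fin n)) (r : ℕ) : Set where
    field
      index : Fin r → Fin n
      onto  : ∀ v → v ∉ ws → ∃ λ t → index t ≡ v

  complement-[] : ∀ {n} → Complement {n} [] n
  complement-[] = record { index = id ; onto = λ v _ → v , refl }

  complement-∷ : ∀ {n r} {ws : List (Fin n)} (u : Fin (suc n)) → Complement ws r →
                 Complement (u ∷ List.map (punchIn u) ws) r
  complement-∷ {ws = ws} u C = record { index = punchIn u ∘ index ; onto = onto′ }
    where
    open Complement C
    onto′ : ∀ v → v ∉ u ∷ List.map (punchIn u) ws → ∃ λ t → punchIn u (index t) ≡ v
    onto′ v v∉ with u Fin.≟ v
    ... | yes refl = contradiction (here refl) v∉
    ... | no  u≢v with onto (punchOut u≢v) (v∉ ∘ there ∘ subst (_∈ _) (punchIn-punchOut u≢v) ∘ ∈-map⁺ (punchIn u))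
    ...   | t , index-t≡v′ = t , trans (cong (punchIn u) index-t≡v′) (punchIn-punchOut u≢v)

  index-vanishes : ∀ {n r} {ws : List (Fin n)} (C : Complement ws r) (y : Point n) →
                   (∀ t → dot (unit (Complement.index C t)) y ≡ 0ℚ) → VanishesOff ws y
  index-vanishes C y rows v v∉ws with Complement.onto C v v∉ws
  ... | t , index-t≡v = trans (sym (dot-unitˡ v y)) (subst (λ u → dot (unit u) y ≡ 0ℚ) index-t≡v (rows t))

  affine-vanishing-dependency : ∀ {n k r} {ws : List (Fin n)} → Complement ws r → suc r ℕ.≤ k → (p : Fin (suc k) → Point n) →
                                Σ (Fin (suc k) → ℚ) λ c → NonTrivial c × ∑ c ≡ 0ℚ × VanishesOff ws (lincomb c p)
  affine-vanishing-dependency C r<k p =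
    let c , nontrivial , ∑c≡0 , rows = affine-dependency (unit ∘ Complement.index C) p r<k
    in  c , nontrivial , ∑c≡0 , index-vanishes C (lincomb c p) rows

  ones : ∀ {n} → Point n
  ones _ = 1ℚ

  relation⇒¬AffIndep : ∀ {n k} {p : Fin k → Point n} (c : Fin k → ℚ) → NonTrivial c → ∑ c ≡ 0ℚ →
                       (∀ v → lincomb c p v ≡ 0ℚ) → ¬ AffIndep p
  relation⇒¬AffIndep c (i , cᵢ≢0) ∑c≡0 comb≡0 indep = cᵢ≢0 (indep c ∑c≡0 comb≡0 i)

  level⇒∑≡0 : ∀ {n k} (a : Point n) {b : ℚ} (p : Fin k → Point n) (c : Fin k → ℚ) → b ≢ 0ℚ →
              (∀ i → dot a (p i) ≡ b) → (∀ v → lincomb c p v ≡ 0ℚ) → ∑ c ≡ 0ℚ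
  level⇒∑≡0 a {b} p c b≢0 level comb≡0 = *-cancel-≢0 b≢0 (begin
    b * ∑ c                     ≡⟨ trans (ℚP.*-comm b (∑ c)) (*-distribʳ-∑ b c) ⟩
    ∑ (λ i → c i * b)           ≡⟨ ∑-cong (λ i → cong (c i *_) (sym (level i))) ⟩
    ∑ (λ i → c i * dot a (p i)) ≡⟨ sym (dot-lincomb a c p) ⟩
    dot a (lincomb c p)         ≡⟨ dot-zeroʳ a comb≡0 ⟩
    0ℚ                          ∎)

  LinIndep : ∀ {n k} → (Fin k → Point n) → Set
  LinIndep p = ∀ c → (∀ v → lincomb c p v ≡ 0ℚ) → ∀ i → c i ≡ 0ℚ

  LinIndep⇒AffIndep : ∀ {n k} {p : Fin k → Point n} → LinIndep p → AffIndep p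
  LinIndep⇒AffIndep indep c _ = indep c

  level-AffIndep⇒LinIndep : ∀ {n k} (a : Point n) {b : ℚ} {p : Fin k → Point n} → b ≢ 0ℚ →
                            (∀ i → dot a (p i) ≡ b) → AffIndep p → LinIndep p
  level-AffIndep⇒LinIndep a {p = p} b≢0 level indep c comb≡0 = indep c (level⇒∑≡0 a p c b≢0 level comb≡0) comb≡0

  LinIndep⇒AffIndep-∷origin : ∀ {n k} {p : Fin k → Point n} → LinIndep p → AffIndep (origin Vec.∷ p)
  LinIndep⇒AffIndep-∷origin {p = p} indep c ∑c≡0 comb≡0 = c≡0
    where
    tail≡0 : ∀ i → c (suc i) ≡ 0ℚ
    tail≡0 = indep (Vec.tail c) λ v → trans (sym (ℚP.+-identityˡ _))
               (trans (cong (_+ lincomb (Vec.tail c) p v) (sym (ℚP.*-zeroʳ (c zero)))) (comb≡0 v))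
    c≡0 : ∀ i → c i ≡ 0ℚ
    c≡0 zero    = trans (sym (ℚP.+-identityʳ (c zero))) (trans (cong (c zero +_) (sym (∑-zero tail≡0))) ∑c≡0)
    c≡0 (suc i) = tail≡0 i

  -- Rank bounds for sets cut out by functionals that are triangular on a few coordinates

  hyperplane-¬AffIndep : ∀ {n k} (p : Fin (suc k) → Point (suc n)) → suc n ℕ.≤ k →
                         (∀ i → dot ones (p i) ≡ 0ℚ) → ¬ AffIndep p
  hyperplane-¬AffIndep {n} p n<k ones·p≡0 =
    let c , nontrivial , ∑c≡0 , off = affine-vanishing-dependency (complement-∷ zero (complement-[] {n})) n<k p
        off′ = peel ones off (dot-lincomb-zero ones c p ones·p≡0) refl λ ()
    in  relation⇒¬AffIndep {p = p} c nontrivial ∑c≡0 (VanishesOff-[] off′)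

  two-sided-¬AffIndep : ∀ {n k} (p : Fin (suc k) → Point (suc n)) → n ℕ.≤ k →
                        (g : Point (suc n)) (u : Fin n) → g zero ≡ 1ℚ → g (suc u) ≡ 0ℚ →
                        (∀ i → dot ones (p i) ≡ 0ℚ) → (∀ i → dot g (p i) ≡ 0ℚ) → ¬ AffIndep p
  two-sided-¬AffIndep {suc n} p n<k g u g0≡1 gu≡0 ones·p≡0 g·p≡0 =
    let c , nontrivial , ∑c≡0 , off = affine-vanishing-dependency (complement-∷ zero (complement-∷ u (complement-[] {n}))) n<k p
        off₁ = peel g off (dot-lincomb-zero g c p g·p≡0) g0≡1 λ { (here refl) → gu≡0 }
        off₂ = peel ones off₁ (dot-lincomb-zero ones c p ones·p≡0) refl λ ()
    in  relation⇒¬AffIndep {p = p} c nontrivial ∑c≡0 (VanishesOff-[] off₂)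

  -- The three exceptional coordinates 0, suc w, suc z are peeled in the order a, b, c.
  three-sided-¬AffIndep : ∀ {n k} (p : Fin k → Point (suc n)) → n ℕ.≤ k →
                          (w z : Fin n) → w ≢ z → (a b c : Fin (suc n)) →
                          zero ∷ suc w ∷ suc z ∷ [] ⊆ a ∷ b ∷ c ∷ [] → (g h : Point (suc n)) →
                          g a ≡ 1ℚ → g b ≡ 0ℚ → g c ≡ 0ℚ → h b ≡ 1ℚ → h c ≡ 0ℚ →
                          (∀ i → dot ones (p i) ≡ 0ℚ) → (∀ i → dot g (p i) ≡ 0ℚ) → (∀ i → dot h (p i) ≡ 0ℚ) →
                          ¬ AffIndep p
  three-sided-¬AffIndep {suc zero} p _ zero zero w≢z = contradiction refl w≢z
  three-sided-¬AffIndep {suc (suc n)} {suc k} p (s≤s n<k) w z w≢z a b c ordering g h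
                        ga≡1 gb≡0 gc≡0 hb≡1 hc≡0 ones·p≡0 g·p≡0 h·p≡0 =
    let C = complement-∷ zero (complement-∷ w (complement-∷ (punchOut w≢z) (complement-[] {n})))
        coeff , nontrivial , ∑c≡0 , off = affine-vanishing-dependency C n<k p
        off₀ = VanishesOff-⊆ (ordering ∘ rename) off
        off₁ = peel g off₀ (dot-lincomb-zero g coeff p g·p≡0) ga≡1 λ { (here refl) → gb≡0 ; (there (here refl)) → gc≡0 }
        off₂ = peel h off₁ (dot-lincomb-zero h coeff p h·p≡0) hb≡1 λ { (here refl) → hc≡0 }
        off₃ = peel ones off₂ (dot-lincomb-zero ones coeff p ones·p≡0) refl λ ()
    in  relation⇒¬AffIndep {p = p} coeff nontrivial ∑c≡0 (VanishesOff-[] off₃)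
    where
    rename : zero ∷ suc w ∷ suc (punchIn w (punchOut w≢z)) ∷ [] ⊆ zero ∷ suc w ∷ suc z ∷ []
    rename (here refl)                 = here refl
    rename (there (here refl))         = there (here refl)
    rename (there (there (here refl))) = there (there (here (cong suc (punchIn-punchOut w≢z))))

  fromℤ : ℤ → ℚ
  fromℤ z = z ℚ./ 1

  private
    fromℤ-viaℚᵘ : ∀ z → ℚ.toℚᵘ (fromℤ z) ℚᵘ.≃ mkℚᵘ z 0
    fromℤ-viaℚᵘ z = ℚP.toℚᵘ-fromℚᵘ (mkℚᵘ z 0)

  fromℤ-+ : ∀ z w → fromℤ (z ℤ.+ w) ≡ fromℤ z + fromℤ w
  fromℤ-+ z w = ℚP.toℚᵘ-injective (ℚᵘP.≃-trans (fromℤ-viaℚᵘ (z ℤ.+ w)) (ℚᵘP.≃-trans +-viaℚᵘ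
    (ℚᵘP.≃-sym (ℚᵘP.≃-trans (ℚP.toℚᵘ-homo-+ (fromℤ z) (fromℤ w))
                            (ℚᵘP.+-cong (fromℤ-viaℚᵘ z) (fromℤ-viaℚᵘ w))))))
    where
    +-viaℚᵘ : mkℚᵘ (z ℤ.+ w) 0 ℚᵘ.≃ (mkℚᵘ z 0 ℚᵘ.+ mkℚᵘ w 0)
    +-viaℚᵘ = *≡* (trans (ℤP.*-identityʳ _)
                (sym (trans (ℤP.*-identityʳ _) (cong₂ ℤ._+_ (ℤP.*-identityʳ z) (ℤP.*-identityʳ w)))))

  fromℤ-- : ∀ z w → fromℤ (z ℤ.- w) ≡ fromℤ z - fromℤ w
  fromℤ-- z w = begin
    fromℤ (z ℤ.- w)                       ≡⟨ S.solve 2 (λ a b → a S.:= (a S.:+ b) S.:- b) refl (fromℤ (z ℤ.- w)) (fromℤ w) ⟩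
    (fromℤ (z ℤ.- w) + fromℤ w) - fromℤ w ≡⟨ cong (_- fromℤ w) (sym (fromℤ-+ (z ℤ.- w) w)) ⟩
    fromℤ ((z ℤ.- w) ℤ.+ w) - fromℤ w     ≡⟨ cong (λ x → fromℤ x - fromℤ w)
                                                   (Z.solve 2 (λ z w → (z Z.:- w) Z.:+ w Z.:= z) refl z w) ⟩
    fromℤ z - fromℤ w                     ∎

  fromℤ-injective : ∀ {z w} → fromℤ z ≡ fromℤ w → z ≡ w
  fromℤ-injective {z} {w} eq
    with ℚᵘP.≃-trans (ℚᵘP.≃-sym (fromℤ-viaℚᵘ z)) (ℚᵘP.≃-trans (ℚP.toℚᵘ-cong eq) (fromℤ-viaℚᵘ w))
  ... | *≡* z*1≡w*1 = trans (sym (ℤP.*-identityʳ z)) (trans z*1≡w*1 (ℤP.*-identityʳ w))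

  fromℤ-mono-≤ : ∀ {z w} → z ℤ.≤ w → fromℤ z ≤ fromℤ w
  fromℤ-mono-≤ {z} {w} z≤w = ℚP.toℚᵘ-cancel-≤
    (ℚᵘP.≤-respˡ-≃ (ℚᵘP.≃-sym (fromℤ-viaℚᵘ z)) (ℚᵘP.≤-respʳ-≃ (ℚᵘP.≃-sym (fromℤ-viaℚᵘ w))
      (*≤* (subst₂ ℤ._≤_ (sym (ℤP.*-identityʳ z)) (sym (ℤP.*-identityʳ w)) z≤w))))

  fromℤ-cancel-≤ : ∀ {z w} → fromℤ z ≤ fromℤ w → z ℤ.≤ w
  fromℤ-cancel-≤ {z} {w} le
    with ℚᵘP.≤-respˡ-≃ (fromℤ-viaℚᵘ z) (ℚᵘP.≤-respʳ-≃ (fromℤ-viaℚᵘ w) (ℚP.toℚᵘ-mono-≤ le))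
  ... | *≤* z*1≤w*1 = subst₂ ℤ._≤_ (ℤP.*-identityʳ z) (ℤP.*-identityʳ w) z*1≤w*1

  size : ∀ {k} → (Fin k → Bool) → ℕ
  size {zero}  S = 0
  size {suc k} S = (if S zero then 1 else 0) ℕ.+ size (Vec.tail S)

  ∅ : ∀ {k} → Fin k → Bool
  ∅ _ = false

  insert : ∀ {k} → (Fin k → Bool) → Fin k → Fin k → Bool
  insert S v = Vec.updateAt S v (λ _ → true)

  size-∅ : ∀ {k} → size (∅ {k}) ≡ 0
  size-∅ {zero}  = refl
  size-∅ {suc k} = size-∅ {k}

  size-≤ : ∀ {k} (S : Fin k → Bool) → size S ℕ.≤ k
  size-≤ {zero}  S = z≤n
  size-≤ {suc k} S with S zero
  ... | true  = s≤s (size-≤ (Vec.tail S))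
  ... | false = ℕP.m≤n⇒m≤1+n (size-≤ (Vec.tail S))

  size-full : ∀ {k} (S : Fin k → Bool) → (∀ v → S v ≡ true) → size S ≡ k
  size-full {zero}  S full = refl
  size-full {suc k} S full rewrite full zero = cong suc (size-full (Vec.tail S) (full ∘ suc))

  size-insert : ∀ {k} (S : Fin k → Bool) v → S v ≡ false → size (insert S v) ≡ suc (size S)
  size-insert S zero Sv≡false rewrite Sv≡false = refl
  size-insert S (suc v) Sv≡false with S zero
  ... | true  = cong suc (size-insert (Vec.tail S) v Sv≡false)
  ... | false = size-insert (Vec.tail S) v Sv≡false

  insert-self : ∀ {k} (S : Fin k → Bool) v → insert S v v ≡ true
  insert-self S v = updateAt-updates v S

  insert-mono : ∀ {k} (S : Fin k → Bool) v {u} → S u ≡ true → insert S v u ≡ true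
  insert-mono S v {u} Su≡true with u Fin.≟ v
  ... | yes refl = insert-self S v
  ... | no  u≢v  = trans (updateAt-minimal u v S u≢v) Su≡true

  insert-other : ∀ {k} (S : Fin k → Bool) v {u} → u ≢ v → insert S v u ≡ S u
  insert-other S v {u} u≢v = updateAt-minimal u v S u≢v

  labels-differ : ∀ {A : Set} {K : A → Bool} {u v} → K u ≡ true → K v ≡ false → K v ≢ K u
  labels-differ Ku Kv Kv≡Ku = contradiction (trans (sym Kv) (trans Kv≡Ku Ku)) λ ()

  distinct-by-label : ∀ {A : Set} {K : A → Bool} {u v} → K u ≡ true → K v ≡ false → v ≢ u
  distinct-by-label {K = K} Ku Kv v≡u = labels-differ {K = K} Ku Kv (cong K v≡u)

  if-same : ∀ {A : Set} c {x y : A} → y ≡ x → (if c then x else y) ≡ x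
  if-same true  _   = refl
  if-same false y≡x = y≡x

  xor-≢ : ∀ {a b} → a ≢ b → a xor b ≡ true
  xor-≢ {true}  {true}  a≢b = contradiction refl a≢b
  xor-≢ {true}  {false} _   = refl
  xor-≢ {false} {true}  _   = refl
  xor-≢ {false} {false} a≢b = contradiction refl a≢b

  xor-true⇒≢ : ∀ {a b} → a xor b ≡ true → a ≢ b
  xor-true⇒≢ {true}  {true}  ()
  xor-true⇒≢ {false} {false} ()
  xor-true⇒≢ {true}  {false} _ ()
  xor-true⇒≢ {false} {true}  _ ()

  xor-false⇒≡ : ∀ {a b} → a xor b ≡ false → a ≡ b
  xor-false⇒≡ {true}  {true}  _ = refl
  xor-false⇒≡ {false} {false} _ = refl

  ≢-≢⇒≡ : ∀ {a b c : Bool} → a ≢ c → b ≢ c → a ≡ b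
  ≢-≢⇒≡ {true}  {true}  _   _   = refl
  ≢-≢⇒≡ {false} {false} _   _   = refl
  ≢-≢⇒≡ {true}  {false} {true}  a≢c _   = contradiction refl a≢c
  ≢-≢⇒≡ {true}  {false} {false} _   b≢c = contradiction refl b≢c
  ≢-≢⇒≡ {false} {true}  {true}  _   b≢c = contradiction refl b≢c
  ≢-≢⇒≡ {false} {true}  {false} a≢c _   = contradiction refl a≢c

  xor-flip : ∀ {a a′ b b′} → a ≢ a′ → b ≢ b′ → a′ xor b′ ≡ a xor b
  xor-flip {a} {a′} {b} {b′} a≢a′ b≢b′ with a | a′ | b | b′
  ... | true  | true  | _     | _     = contradiction refl a≢a′
  ... | false | false | _     | _     = contradiction refl a≢a′
  ... | _     | _     | true  | true  = contradiction refl b≢b′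
  ... | _     | _     | false | false = contradiction refl b≢b′
  ... | true  | false | true  | false = refl
  ... | true  | false | false | true  = refl
  ... | false | true  | true  | false = refl
  ... | false | true  | false | true  = refl

  xor-swap : ∀ a b c d → a xor b ≡ c xor d → a xor c ≡ b xor d
  xor-swap a b c d ab≡cd = begin
    a xor c                 ≡⟨ cong (a xor_) (sym c≡cd-d) ⟩
    a xor ((c xor d) xor d) ≡⟨ cong (λ t → a xor (t xor d)) (sym ab≡cd) ⟩
    a xor ((a xor b) xor d) ≡⟨ cong (a xor_) (BoolP.xor-assoc a b d) ⟩
    a xor (a xor (b xor d)) ≡⟨ sym (BoolP.xor-assoc a a (b xor d)) ⟩
    (a xor a) xor (b xor d) ≡⟨ cong (_xor (b xor d)) (BoolP.xor-same a) ⟩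
    b xor d                 ∎
    where
    c≡cd-d : (c xor d) xor d ≡ c
    c≡cd-d = trans (BoolP.xor-assoc c d d) (trans (cong (c xor_) (BoolP.xor-same d)) (BoolP.xor-identityʳ c))

  -- Walks and spanning forests in a digraph

  module Connectivity {n m : ℕ} (tl hd : Fin m → Fin n) where
    open Graph tl hd

    reach-trans : ∀ {R u v w} → Reach R u v → Reach R v w → Reach R u w
    reach-trans p here        = p
    reach-trans p (fwd r q)   = fwd r (reach-trans p q)
    reach-trans p (bwd r q)   = bwd r (reach-trans p q)

    reach-sym : ∀ {R u v} → Reach R u v → Reach R v u
    reach-sym here      = here
    reach-sym (fwd r q) = reach-trans (bwd r here) (reach-sym q)
    reach-sym (bwd r q) = reach-trans (fwd r here) (reach-sym q)

    reach-mono : ∀ {R R′ : Fin m → Set} {u v} → (∀ {e} → R e → R′ e) → Reach R u v → Reach R′ u v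
    reach-mono R⊆R′ here      = here
    reach-mono R⊆R′ (fwd r q) = fwd (R⊆R′ r) (reach-mono R⊆R′ q)
    reach-mono R⊆R′ (bwd r q) = bwd (R⊆R′ r) (reach-mono R⊆R′ q)

    Stable : ∀ {A : Set} → (Fin m → Set) → (Fin n → A) → Set
    Stable R K = ∀ e → R e → K (tl e) ≡ K (hd e)

    reach-stable : ∀ {A : Set} {R} {K : Fin n → A} {u v} → Stable R K → Reach R u v → K u ≡ K v
    reach-stable K-stable here            = refl
    reach-stable K-stable (fwd {e} r q)   = trans (reach-stable K-stable q) (K-stable e r)
    reach-stable K-stable (bwd {e} r q)   = trans (reach-stable K-stable q) (sym (K-stable e r))

    reach-crossing : (K : Fin n → Bool) {R : Fin m → Set} {u v : Fin n} → Reach R u v → K u ≢ K v →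
                     ∃ λ e → R e × K (tl e) ≢ K (hd e)
    reach-crossing K here Ku≢Kv = contradiction refl Ku≢Kv
    reach-crossing K {u = u} (fwd {e} r q) Ku≢Kv with K u Data.Bool.≟ K (tl e)
    ... | yes Ku≡Kt = e , r , λ Kt≡Kh → Ku≢Kv (trans Ku≡Kt Kt≡Kh)
    ... | no  Ku≢Kt = reach-crossing K q Ku≢Kt
    reach-crossing K {u = u} (bwd {e} r q) Ku≢Kv with K u Data.Bool.≟ K (hd e)
    ... | yes Ku≡Kh = e , r , λ Kt≡Kh → Ku≢Kv (trans Ku≡Kh (sym Kt≡Kh))
    ... | no  Ku≢Kh = reach-crossing K q Ku≢Kh

    Separated : (Fin m → Set) → Fin n → Fin n → Set
    Separated R a b = Σ (Fin n → Bool) λ K → K a ≡ true × K b ≡ false × Stable R K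

    Attaches : (Fin n → Bool) → Fin m → Fin n → Set
    Attaches S e v = (hd e ≡ v × S (tl e) ≡ true) ⊎ (tl e ≡ v × S (hd e) ≡ true)

    -- Forests grown from the seed set S₀, one new vertex per edge; the newest edge has index zero.
    data Forest (R : Fin m → Set) (S₀ : Fin n → Bool) : ∀ {k} → (Fin n → Bool) → (Fin k → Fin m) → Set where
      seeds : Forest R S₀ S₀ Vec.[]
      grow  : ∀ {k S f} e v → Forest R S₀ {k} S f → S v ≡ false → R e → Attaches S e v →
              Forest R S₀ (insert S v) (e Vec.∷ f)

    module _ {R : Fin m → Set} {S₀ : Fin n → Bool} where

      forest-seeds : ∀ {k S f} → Forest R S₀ {k} S f → ∀ {v} → S₀ v ≡ true → S v ≡ true
      forest-seeds seeds                     S₀v = S₀v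
      forest-seeds (grow {S = S} e v F _ _ _) S₀v = insert-mono S v (forest-seeds F S₀v)

      forest-edges : ∀ {k S f} → Forest R S₀ {k} S f → ∀ i → R (f i)
      forest-edges (grow e v F _ r _) zero    = r
      forest-edges (grow e v F _ r _) (suc i) = forest-edges F i

      forest-ends : ∀ {k S f} → Forest R S₀ {k} S f → ∀ i → S (tl (f i)) ≡ true × S (hd (f i)) ≡ true
      forest-ends (grow {S = S} e v F _ _ (inj₁ (refl , St))) zero = insert-mono S v St , insert-self S v
      forest-ends (grow {S = S} e v F _ _ (inj₂ (refl , Sh))) zero = insert-self S v , insert-mono S v Sh
      forest-ends (grow {S = S} e v F _ _ _) (suc i) =
        let St , Sh = forest-ends F i in insert-mono S v St , insert-mono S v Sh

      forest-size : ∀ {k S f} → Forest R S₀ {k} S f → size S ≡ k ℕ.+ size S₀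
      forest-size seeds                    = refl
      forest-size (grow {S = S} e v F Sv _ _) = trans (size-insert S v Sv) (cong suc (forest-size F))

      forest-reach : ∀ {k S f} → Forest R S₀ {k} S f → ∀ {v} → S v ≡ true → ∃ λ u → S₀ u ≡ true × Reach R u v
      forest-reach seeds {v} S₀v = v , S₀v , here
      forest-reach (grow {S = S} e w F Sw r side) {v} Sv with v Fin.≟ w | side
      ... | no  v≢w | _ = forest-reach F (trans (sym (insert-other S w v≢w)) Sv)
      ... | yes refl | inj₁ (refl , St) = let u , S₀u , u⇝t = forest-reach F St in u , S₀u , fwd r u⇝t
      ... | yes refl | inj₂ (refl , Sh) = let u , S₀u , u⇝h = forest-reach F Sh in u , S₀u , bwd r u⇝h

      forest-truncate : ∀ {j k S f} → j ℕ.≤ k → Forest R S₀ {k} S f →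
                        Σ (Fin n → Bool) λ S′ → Σ (Fin j → Fin m) λ f′ → Forest R S₀ S′ f′
      forest-truncate {j} {k} j≤k F with j ℕ.≟ k
      ... | yes refl = _ , _ , F
      forest-truncate z≤n seeds              | no 0≢0 = contradiction refl 0≢0
      forest-truncate j≤k (grow e v F _ _ _) | no j≢k = forest-truncate (ℕP.m<1+n⇒m≤n (ℕP.≤∧≢⇒< j≤k j≢k)) F

      xe-outside : ∀ {S : Fin n → Bool} e {v} → S (tl e) ≡ true → S (hd e) ≡ true → S v ≡ false → xe e v ≡ 0ℚ
      xe-outside {S} e {v} St Sh Sv =
        cong₂ _-_ (unit-other (hd e) v (distinct-by-label {K = S} Sh Sv)) (unit-other (tl e) v (distinct-by-label {K = S} St Sv))

      xe-attached : ∀ {S : Fin n → Bool} e {v} → Attaches S e v → S v ≡ false → xe e v ≢ 0ℚ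
      xe-attached {S} e {v} (inj₁ (refl , St)) Sv xe≡0 =
        1≢0 (trans (sym (cong₂ _-_ (unit-same v) (unit-other (tl e) v (distinct-by-label {K = S} St Sv)))) xe≡0)
      xe-attached {S} e {v} (inj₂ (refl , Sh)) Sv xe≡0 =
        1≢0 (ℚP.neg-injective (trans (sym (cong₂ _-_ (unit-other (hd e) v (distinct-by-label {K = S} Sh Sv)) (unit-same v))) xe≡0))

      -- The newest vertex of a forest lies on its newest edge only.
      forest-LinIndep : ∀ {k S f} → Forest R S₀ {k} S f → LinIndep (xe ∘ f)
      forest-LinIndep seeds c _ ()
      forest-LinIndep (grow {S = S} {f} e v F Sv _ side) c comb≡0 = c≡0
        where
        older-at-v : lincomb (Vec.tail c) (xe ∘ f) v ≡ 0ℚ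
        older-at-v = ∑-zero λ i → let St , Sh = forest-ends F i in
          trans (cong (c (suc i) *_) (xe-outside {S} (f i) St Sh Sv)) (ℚP.*-zeroʳ (c (suc i)))
        head≡0 : c zero ≡ 0ℚ
        head≡0 = *-cancel-≢0 (xe-attached e side Sv) (begin
          xe e v * c zero                                ≡⟨ ℚP.*-comm (xe e v) (c zero) ⟩
          c zero * xe e v                                ≡⟨ sym (ℚP.+-identityʳ _) ⟩
          c zero * xe e v + 0ℚ                           ≡⟨ cong (c zero * xe e v +_) (sym older-at-v) ⟩
          c zero * xe e v + lincomb (Vec.tail c) (xe ∘ f) v ≡⟨ comb≡0 v ⟩
          0ℚ                                             ∎)
        newest≡0 : ∀ u → c zero * xe e u ≡ 0ℚ
        newest≡0 u = trans (cong (_* xe e u) head≡0) (ℚP.*-zeroˡ (xe e u))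
        tail≡0 : ∀ i → c (suc i) ≡ 0ℚ
        tail≡0 = forest-LinIndep F (Vec.tail c) λ u → begin
          lincomb (Vec.tail c) (xe ∘ f) u                   ≡⟨ sym (ℚP.+-identityˡ _) ⟩
          0ℚ + lincomb (Vec.tail c) (xe ∘ f) u              ≡⟨ cong (_+ lincomb (Vec.tail c) (xe ∘ f) u) (sym (newest≡0 u)) ⟩
          c zero * xe e u + lincomb (Vec.tail c) (xe ∘ f) u ≡⟨ comb≡0 u ⟩
          0ℚ                                                ∎
        c≡0 : ∀ i → c i ≡ 0ℚ
        c≡0 zero    = head≡0
        c≡0 (suc i) = tail≡0 i

      Maximal : Set
      Maximal = Σ ℕ λ k → Σ (Fin n → Bool) λ S → Σ (Fin k → Fin m) λ f → Forest R S₀ S f × Stable R S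

      crossing? : (∀ e → Dec (R e)) → (S : Fin n → Bool) → (∃ λ e → R e × S (tl e) ≢ S (hd e)) ⊎ Stable R S
      crossing? R? S with any? (λ e → R? e ×-dec ¬? (S (tl e) Data.Bool.≟ S (hd e)))
      ... | yes found = inj₁ found
      ... | no  none  = inj₂ λ e r → decidable-stable (S (tl e) Data.Bool.≟ S (hd e)) (λ St≢Sh → none (e , r , St≢Sh))

      extend : ∀ {k S f} → Forest R S₀ {k} S f → ∀ e → R e → S (tl e) ≢ S (hd e) →
               Σ (Fin n → Bool) λ S′ → Σ (Fin (suc k) → Fin m) λ f′ → Forest R S₀ S′ f′
      extend {S = S} F e r St≢Sh with S (tl e) in St | S (hd e) in Sh
      ... | true  | false = _ , _ , grow e (hd e) F Sh r (inj₁ (refl , St))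
      ... | false | true  = _ , _ , grow e (tl e) F St r (inj₂ (refl , Sh))
      ... | true  | true  = contradiction refl St≢Sh
      ... | false | false = contradiction refl St≢Sh

      -- Each extension adds a vertex, so at most n − size S₀ extensions are possible.
      saturate : (∀ e → Dec (R e)) → ∀ fuel {k S f} → Forest R S₀ {k} S f → n ℕ.≤ fuel ℕ.+ size S → Maximal
      saturate R? fuel {k} {S} {f} F bound with crossing? R? S
      ... | inj₂ stable = k , S , f , F , stable
      ... | inj₁ (e , r , St≢Sh) with extend F e r St≢Sh
      ...   | S′ , f′ , F′ with trans (forest-size F′) (cong suc (sym (forest-size F))) | fuel
      ...     | grown | zero      = contradiction (ℕP.≤-trans (ℕP.≤-reflexive (sym grown)) (ℕP.≤-trans (size-≤ S′) bound))
                                                  (ℕP.n≮n (size S))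
      ...     | grown | suc fuel′ = saturate R? fuel′ F′
                                      (ℕP.≤-trans bound (ℕP.≤-reflexive
                                        (trans (sym (ℕP.+-suc fuel′ (size S))) (cong (fuel′ ℕ.+_) (sym grown)))))

      maximal-forest : (∀ e → Dec (R e)) → Maximal
      maximal-forest R? = saturate R? n seeds (ℕP.m≤m+n n (size S₀))

    singleton : Fin n → Fin n → Bool
    singleton a = insert ∅ a

    singleton-≡ : ∀ {a u} → singleton a u ≡ true → u ≡ a
    singleton-≡ {a} {u} a∋u with u Fin.≟ a
    ... | yes u≡a = u≡a
    ... | no  u≢a = contradiction (trans (sym (insert-other ∅ a u≢a)) a∋u) λ ()

    reach? : ∀ {R} → (∀ e → Dec (R e)) → ∀ a b → Reach R a b ⊎ Separated R a b
    reach? {R} R? a b with maximal-forest {S₀ = singleton a} R?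
    ... | k , S , f , F , stable with S b in Sb
    ...   | true  = let u , a∋u , u⇝b = forest-reach F Sb in inj₁ (subst (λ u → Reach R u b) (singleton-≡ a∋u) u⇝b)
    ...   | false = inj₂ (S , forest-seeds F (insert-self ∅ a) , Sb , stable)

    spanning-forest : ∀ {R} → (∀ e → Dec (R e)) → (S₀ : Fin n → Bool) → (∀ v → ∃ λ u → S₀ u ≡ true × Reach R u v) →
                      Σ ℕ λ k → Σ (Fin n → Bool) λ S → Σ (Fin k → Fin m) λ f → Forest R S₀ S f × k ℕ.+ size S₀ ≡ n
    spanning-forest R? S₀ covered with maximal-forest {S₀ = S₀} R?
    ... | k , S , f , F , stable = k , S , f , F , trans (sym (forest-size F)) (size-full S full)
      where
      full : ∀ v → S v ≡ true
      full v = let u , S₀u , u⇝v = covered v in trans (sym (reach-stable stable u⇝v)) (forest-seeds F S₀u)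

    reach-potential : ∀ {R} (a : Fin n → ℚ) (b : ℚ) → (∀ e → R e → a (hd e) ≡ a (tl e) + b) →
                      ∀ {u v} → Reach R u v → ∃ λ z → a v ≡ a u + fromℤ z * b
    reach-potential a b step {u} here = ℤ.+ 0 , sym (trans (cong (a u +_) (ℚP.*-zeroˡ b)) (ℚP.+-identityʳ (a u)))
    reach-potential a b step {u} (fwd {e} r q) =
      let z , av≡ = reach-potential a b step q in z ℤ.+ ℤ.+ 1 , (begin
        a (hd e)                          ≡⟨ step e r ⟩
        a (tl e) + b                      ≡⟨ cong (_+ b) av≡ ⟩
        a u + fromℤ z * b + b             ≡⟨ S.solve 3 (λ A z b → A S.:+ z S.:* b S.:+ b S.:= A S.:+ (z S.:+ S.con 1ℚ) S.:* b)
                                                       refl (a u) (fromℤ z) b ⟩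
        a u + (fromℤ z + 1ℚ) * b          ≡⟨ cong (λ t → a u + t * b) (sym (fromℤ-+ z (ℤ.+ 1))) ⟩
        a u + fromℤ (z ℤ.+ ℤ.+ 1) * b     ∎)
    reach-potential a b step {u} (bwd {e} r q) =
      let z , av≡ = reach-potential a b step q in z ℤ.- ℤ.+ 1 , (begin
        a (tl e)                          ≡⟨ S.solve 2 (λ t b → t S.:= (t S.:+ b) S.:- b) refl (a (tl e)) b ⟩
        a (tl e) + b - b                  ≡⟨ cong (_- b) (sym (step e r)) ⟩
        a (hd e) - b                      ≡⟨ cong (_- b) av≡ ⟩
        a u + fromℤ z * b - b             ≡⟨ S.solve 3 (λ A z b → A S.:+ z S.:* b S.:- b S.:= A S.:+ (z S.:- S.con 1ℚ) S.:* b)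
                                                       refl (a u) (fromℤ z) b ⟩
        a u + (fromℤ z - 1ℚ) * b          ≡⟨ cong (λ t → a u + t * b) (sym (fromℤ-- z (ℤ.+ 1))) ⟩
        a u + fromℤ (z ℤ.- ℤ.+ 1) * b     ∎)

    reach-dec : ∀ {R} → (∀ e → Dec (R e)) → ∀ a b → Dec (Reach R a b)
    reach-dec R? a b with reach? R? a b
    ... | inj₁ a⇝b = yes a⇝b
    ... | inj₂ (K , Ka , Kb , K-stable) = no λ a⇝b → contradiction (trans (sym Ka) (trans (reach-stable K-stable a⇝b) Kb)) λ ()

    connected-or-separated : ∀ {R} → (∀ e → Dec (R e)) → ∀ a → (∀ v → Reach R a v) ⊎ ∃ λ w → Separated R a w
    connected-or-separated R? a with all? (reach-dec R? a)
    ... | yes a⇝all = inj₁ a⇝all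
    ... | no  ¬a⇝all with ¬∀⟶∃¬ _ _ (reach-dec R? a) ¬a⇝all
    ...   | w , ¬a⇝w with reach? R? a w
    ...     | inj₁ a⇝w = contradiction a⇝w ¬a⇝w
    ...     | inj₂ sep = inj₂ (w , sep)

    size-singleton : ∀ a → size (singleton a) ≡ 1
    size-singleton a = trans (size-insert ∅ a refl) (cong suc (size-∅ {n}))

    same-cut⇒xor-constant : Connected → ∀ (K P : Fin n → Bool) → (∀ e → cutOf K e ≡ cutOf P e) →
                            ∀ a v → K v xor P v ≡ K a xor P a
    same-cut⇒xor-constant (_ , conn) K P same a v =
      sym (reach-stable (λ e _ → xor-swap (K (tl e)) (K (hd e)) (P (tl e)) (P (hd e)) (same e)) (conn a v))

    xor-constant⇒same-cut : ∀ (K P : Fin n → Bool) {c} → (∀ v → K v xor P v ≡ c) → ∀ e → cutOf K e ≡ cutOf P e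
    xor-constant⇒same-cut K P K⊕P≡c e =
      xor-swap (K (tl e)) (P (tl e)) (K (hd e)) (P (hd e)) (trans (K⊕P≡c (tl e)) (sym (K⊕P≡c (hd e))))

    Uncut : EdgeSet → Fin m → Set
    Uncut C e = C e ≡ false

    -- A second cut inside C would be a proper subcut, so each shore is connected outside C.
    shore-connected : Connected → ∀ C P → Elementary C → C ≡ₑ cutOf P → ∀ a b → P a ≡ P b → Reach (Uncut C) a b
    shore-connected conn C P (_ , minimal) C≡P a b Pa≡Pb with reach? (λ e → C e Data.Bool.≟ false) a b
    ... | inj₁ a⇝b = a⇝b
    ... | inj₂ (K , Ka , Kb , K-stable) = contradiction (same-cut⇒xor-constant conn K P D≡P a b) Kb⊕Pb≢Ka⊕Pa
      where
      D⊆C : cutOf K ⊆ₑ C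
      D⊆C e De with C e in Ce
      ... | true  = refl
      ... | false = contradiction (trans (sym De) (trans (cong (_xor K (hd e)) (K-stable e Ce)) (BoolP.xor-same (K (hd e))))) λ ()
      crossing : ∃ λ e → ⊤ × K (tl e) ≢ K (hd e)
      crossing = reach-crossing K (proj₂ conn a b) (λ Ka≡Kb → contradiction (trans (sym Ka) (trans Ka≡Kb Kb)) λ ())
      D-cut : IsCut (cutOf K)
      D-cut = (K , λ e → refl) , proj₁ crossing , xor-≢ (proj₂ (proj₂ crossing))
      D≡P : ∀ e → cutOf K e ≡ cutOf P e
      D≡P e = trans (minimal (cutOf K) D-cut D⊆C e) (C≡P e)
      Kb⊕Pb≢Ka⊕Pa : K b xor P b ≢ K a xor P a
      Kb⊕Pb≢Ka⊕Pa rewrite Ka | Kb | Pa≡Pb with P b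
      ... | true  = λ ()
      ... | false = λ ()

  -- The polytope Q̃_G and its faces

  module Polytope {n m : ℕ} (tl hd : Fin m → Fin n) where
    open Graph tl hd

    dot-xe : ∀ (g : Point n) e → dot g (xe e) ≡ g (hd e) - g (tl e)
    dot-xe g e = begin
      ∑ (λ v → g v * (unit (hd e) v - unit (tl e) v))
        ≡⟨ ∑-cong (λ v → ℚP.*-distribˡ-+ (g v) (unit (hd e) v) (- unit (tl e) v)) ⟩
      ∑ (λ v → g v * unit (hd e) v + g v * (- unit (tl e) v))
        ≡⟨ ∑-cong (λ v → cong (g v * unit (hd e) v +_) (sym (ℚP.neg-distribʳ-* (g v) (unit (tl e) v)))) ⟩
      ∑ (λ v → g v * unit (hd e) v - g v * unit (tl e) v)
        ≡⟨ ∑-- (λ v → g v * unit (hd e) v) (λ v → g v * unit (tl e) v) ⟩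
      dot g (unit (hd e)) - dot g (unit (tl e))
        ≡⟨ cong₂ _-_ (dot-unitʳ g (hd e)) (dot-unitʳ g (tl e)) ⟩
      g (hd e) - g (tl e) ∎

    Q-gens : ∀ j → Q (gens j)
    Q-gens j = unit j , unit-nonneg j , ∑-unit j , λ v → sym (dot-unitˡ j (λ i → gens i v))

    Q-origin : Q origin
    Q-origin = Q-gens zero

    Q-xe : ∀ e → Q (xe e)
    Q-xe e = Q-gens (suc e)

    dot-Q : ∀ (g : Point n) {x} (x∈Q : Q x) → dot g x ≡ ∑ (λ j → proj₁ x∈Q j * dot g (gens j))
    dot-Q g (c , _ , _ , x≡comb) = trans (dot-congʳ g x≡comb) (dot-lincomb g c gens)

    Valid : Point n → ℚ → Set
    Valid a b = ∀ x → Q x → dot a x ≤ b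

    valid-on-gens : ∀ (a : Point n) b → (∀ j → dot a (gens j) ≤ b) → Valid a b
    valid-on-gens a b a≤b x x∈Q@(c , c≥0 , ∑c≡1 , _) =
      ℚP.≤-trans (ℚP.≤-reflexive (dot-Q a x∈Q))
        (ℚP.≤-trans (∑-mono-≤ (λ j → ℚP.*-monoˡ-≤-nonNeg (c j) {{ℚ.nonNegative (c≥0 j)}} (a≤b j)))
          (ℚP.≤-reflexive (trans (sym (*-distribʳ-∑ b c)) (trans (cong (_* b) ∑c≡1) (ℚP.*-identityˡ b)))))

    vanishing-on-gens : ∀ (g : Point n) → (∀ j → dot g (gens j) ≡ 0ℚ) → ∀ {x} → Q x → dot g x ≡ 0ℚ
    vanishing-on-gens g g·gens≡0 x∈Q =
      trans (dot-Q g x∈Q) (∑-zero λ j → trans (cong (proj₁ x∈Q j *_) (g·gens≡0 j)) (ℚP.*-zeroʳ (proj₁ x∈Q j)))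

    Q-ones : ∀ {x} → Q x → dot ones x ≡ 0ℚ
    Q-ones = vanishing-on-gens ones λ { zero → dot-origin {n} ones ; (suc e) → trans (dot-xe ones e) (ℚP.+-inverseʳ 1ℚ) }

    -- Only functionals modulo multiples of 𝟏 matter on Q̃.
    dot-affine-Q : ∀ (α β : ℚ) (a g : Point n) → (∀ v → a v ≡ α + β * g v) → ∀ {x} → Q x → dot a x ≡ β * dot g x
    dot-affine-Q α β a g a≗ {x} x∈Q = begin
      dot a x                                   ≡⟨ dot-congˡ x (λ v → trans (a≗ v) (cong (_+ β * g v) (sym (ℚP.*-identityʳ α)))) ⟩
      dot (λ v → α * ones v + β * g v) x        ≡⟨ dot-linearˡ α β ones g x ⟩
      α * dot ones x + β * dot g x              ≡⟨ cong (λ t → α * t + β * dot g x) (Q-ones x∈Q) ⟩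
      α * 0ℚ + β * dot g x                      ≡⟨ S.solve 2 (λ α y → α S.:* S.con 0ℚ S.:+ y S.:= y) refl α (β * dot g x) ⟩
      β * dot g x                               ∎

    face-support : ∀ (a : Point n) b → Valid a b → ∀ {x} (x∈Q : Q x) → dot a x ≡ b →
                   ∀ j → proj₁ x∈Q j ≡ 0ℚ ⊎ dot a (gens j) ≡ b
    face-support a b valid {x} x∈Q@(c , c≥0 , ∑c≡1 , _) a·x≡b j with c j ℚ.≟ 0ℚ
    ... | yes cⱼ≡0 = inj₁ cⱼ≡0
    ... | no  cⱼ≢0 = inj₂ (sym (p-q≡0⇒p≡q (*-cancel-≢0 cⱼ≢0 (∑-nonneg≡0 slack≥0 ∑slack≡0 j))))
      where
      slack : Fin (suc m) → ℚ
      slack i = c i * (b - dot a (gens i))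
      slack≥0 : ∀ i → 0ℚ ≤ slack i
      slack≥0 i = ℚP.nonNegative⁻¹ (slack i)
        {{ℚP.nonNeg*nonNeg⇒nonNeg (c i) {{ℚ.nonNegative (c≥0 i)}} _ {{ℚ.nonNegative (p≤q⇒0≤q-p (valid (gens i) (Q-gens i)))}}}}
      ∑slack≡0 : ∑ slack ≡ 0ℚ
      ∑slack≡0 = begin
        ∑ slack
          ≡⟨ ∑-cong (λ i → S.solve 3 (λ c b a → c S.:* (b S.:- a) S.:= c S.:* b S.:- c S.:* a) refl (c i) b (dot a (gens i))) ⟩
        ∑ (λ i → c i * b - c i * dot a (gens i))
          ≡⟨ ∑-- (λ i → c i * b) (λ i → c i * dot a (gens i)) ⟩
        ∑ (λ i → c i * b) - ∑ (λ i → c i * dot a (gens i))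
          ≡⟨ cong₂ _-_ (trans (sym (*-distribʳ-∑ b c)) (trans (cong (_* b) ∑c≡1) (ℚP.*-identityˡ b))) (sym (dot-Q a x∈Q)) ⟩
        b - dot a x
          ≡⟨ cong (λ t → b - t) a·x≡b ⟩
        b - b
          ≡⟨ ℚP.+-inverseʳ b ⟩
        0ℚ ∎

    face-vanishing : ∀ (a : Point n) b → Valid a b → ∀ {x} → Q x → dot a x ≡ b →
                     ∀ (g : Point n) → (∀ j → dot a (gens j) ≡ b → dot g (gens j) ≡ 0ℚ) → dot g x ≡ 0ℚ
    face-vanishing a b valid x∈Q a·x≡b g g-face = trans (dot-Q g x∈Q) (∑-zero term≡0)
      where
      term≡0 : ∀ j → proj₁ x∈Q j * dot g (gens j) ≡ 0ℚ
      term≡0 j with face-support a b valid x∈Q a·x≡b j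
      ... | inj₁ cⱼ≡0     = trans (cong (_* dot g (gens j)) cⱼ≡0) (ℚP.*-zeroˡ (dot g (gens j)))
      ... | inj₂ on-face  = trans (cong (proj₁ x∈Q j *_) (g-face j on-face)) (ℚP.*-zeroʳ (proj₁ x∈Q j))

    dot-fvec-xe : ∀ (K : Fin n → Bool) e → K (tl e) ≡ K (hd e) → dot (fvec K) (xe e) ≡ 0ℚ
    dot-fvec-xe K e Kt≡Kh = trans (dot-xe (fvec K) e) (trans (cong (λ b → fvec K (hd e) - (if b then 1ℚ else 0ℚ)) Kt≡Kh)
                                                           (ℚP.+-inverseʳ (fvec K (hd e))))

    side : (Fin n → Bool) → Fin n → Point n
    side K u = fvec (λ v → does (K v Data.Bool.≟ K u))

    side-self : ∀ K u → side K u u ≡ 1ℚ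
    side-self K u with K u
    ... | true  = refl
    ... | false = refl

    side-other : ∀ K u {v} → K v ≢ K u → side K u v ≡ 0ℚ
    side-other K u {v} Kv≢Ku with K v Data.Bool.≟ K u
    ... | yes Kv≡Ku = contradiction Kv≡Ku Kv≢Ku
    ... | no  _     = refl

    side-vanishing : ∀ K u {x} → Q x → dot (fvec K) x ≡ 0ℚ → dot (side K u) x ≡ 0ℚ
    side-vanishing K u x∈Q K·x≡0 =
      trans (dot-affine-Q α β (side K u) (fvec K) side≗ x∈Q) (trans (cong (β *_) K·x≡0) (ℚP.*-zeroʳ β))
      where
      α β : ℚ
      α = if K u then 0ℚ else 1ℚ
      β = if K u then 1ℚ else - 1ℚ
      side≗ : ∀ v → side K u v ≡ α + β * fvec K v
      side≗ v with K u | K v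
      ... | true  | true  = refl
      ... | true  | false = refl
      ... | false | true  = refl
      ... | false | false = refl


  -- Facets of Q̃_G; vertex zero serves as the root

  module Facets {n0 m : ℕ} (tl hd : Fin m → Fin (suc n0)) where
    open Graph tl hd
    open Connectivity tl hd
    open Polytope tl hd

    spanning-tree : ∀ {R} → (∀ e → Dec (R e)) → SpanConnected R →
                    Σ (Fin (suc n0) → Bool) λ S → Σ (Fin n0 → Fin m) λ f → Forest R (singleton zero) S f
    spanning-tree {R} R? conn =
      let k , S , f , F , k+1≡N = spanning-forest R? (singleton zero) (λ v → zero , insert-self (∅ {suc n0}) zero , conn zero v)
      in  subst (λ k → Σ (Fin (suc n0) → Bool) λ S → Σ (Fin k → Fin m) λ f → Forest R (singleton zero) S f)
                (ℕP.suc-injective (trans (trans (ℕP.+-comm 1 k) (cong (k ℕ.+_) (sym (size-singleton zero)))) k+1≡N))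
                (S , f , F)

    Q-family : Connected → ∀ j → j ℕ.≤ n0 → Σ (Fin (suc j) → Point (suc n0)) λ p → (∀ i → Q (p i)) × AffIndep p
    Q-family (_ , conn) j j≤n0 =
      let S , f , F = spanning-tree (λ _ → yes tt) conn
          S′ , f′ , F′ = forest-truncate j≤n0 F
      in  origin Vec.∷ (xe ∘ f′) , (λ { zero → Q-origin ; (suc i) → Q-xe (f′ i) }) ,
          LinIndep⇒AffIndep-∷origin (forest-LinIndep F′)

    Q-rank : Connected → HasRank Q (suc n0)
    Q-rank conn = Q-family conn n0 ℕP.≤-refl , λ p p∈Q → hyperplane-¬AffIndep p ℕP.≤-refl (Q-ones ∘ p∈Q)

    facet-rank≥ : Connected → ∀ r → HasRank Q (suc r) → n0 ℕ.≤ r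
    facet-rank≥ conn r (_ , bound) with n0 ℕ.≤? r
    ... | yes n0≤r = n0≤r
    ... | no  n0≰r = let p , p∈Q , indep = Q-family conn (suc r) (ℕP.≰⇒> n0≰r) in contradiction indep (bound p p∈Q)

    -- Adjoining the origin to points on a level set not through it raises the rank.
    Q-level-¬AffIndep : ∀ {k} (a : Point (suc n0)) {b} → b ≢ 0ℚ → (p : Fin (suc k) → Point (suc n0)) → n0 ℕ.≤ k →
                        (∀ i → Q (p i)) → (∀ i → dot a (p i) ≡ b) → ¬ AffIndep p
    Q-level-¬AffIndep a b≢0 p n0≤k p∈Q level indep =
      hyperplane-¬AffIndep (origin Vec.∷ p) (s≤s n0≤k) (λ { zero → dot-origin {suc n0} ones ; (suc i) → Q-ones (p∈Q i) })
        (LinIndep⇒AffIndep-∷origin {p = p} (level-AffIndep⇒LinIndep a {p = p} b≢0 level indep))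

    dot-ℓ-xe : ∀ (ℓ : Fin (suc n0) → ℤ) e → dot (toℚ ℓ) (xe e) ≡ fromℤ (ℓ (hd e) ℤ.- ℓ (tl e))
    dot-ℓ-xe ℓ e = trans (dot-xe (toℚ ℓ) e) (sym (fromℤ-- (ℓ (hd e)) (ℓ (tl e))))

    tight⇔level : ∀ ℓ e → Tight ℓ e ⇔ dot (toℚ ℓ) (xe e) ≡ 1ℚ
    tight⇔level ℓ e = mk⇔
      (λ tight → trans (dot-ℓ-xe ℓ e) (cong fromℤ (begin
        ℓ (hd e) ℤ.- ℓ (tl e)           ≡⟨ cong (ℤ._- ℓ (tl e)) tight ⟩
        ℓ (tl e) ℤ.+ ℤ.+ 1 ℤ.- ℓ (tl e) ≡⟨ Z.solve 1 (λ t → t Z.:+ Z.con (ℤ.+ 1) Z.:- t Z.:= Z.con (ℤ.+ 1)) refl (ℓ (tl e)) ⟩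
        ℤ.+ 1                           ∎)))
      (λ level → begin
        ℓ (hd e)                                  ≡⟨ Z.solve 2 (λ h t → h Z.:= t Z.:+ (h Z.:- t)) refl (ℓ (hd e)) (ℓ (tl e)) ⟩
        ℓ (tl e) ℤ.+ (ℓ (hd e) ℤ.- ℓ (tl e))      ≡⟨ cong (λ d → ℓ (tl e) ℤ.+ d)
                                                       (fromℤ-injective (trans (sym (dot-ℓ-xe ℓ e)) level)) ⟩
        ℓ (tl e) ℤ.+ ℤ.+ 1                        ∎)

    layerFace-rank : ∀ ℓ → Admissible ℓ → HasRank (layerFace ℓ) n0
    layerFace-rank ℓ (_ , tight-conn) = (xe ∘ f , on-face , LinIndep⇒AffIndep (forest-LinIndep F)) , upper
      where
      tree : Σ (Fin (suc n0) → Bool) λ S → Σ (Fin n0 → Fin m) λ f → Forest (Tight ℓ) (singleton zero) S f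
      tree = spanning-tree (λ e → ℓ (hd e) ℤ.≟ ℓ (tl e) ℤ.+ ℤ.+ 1) tight-conn
      f : Fin n0 → Fin m
      f = proj₁ (proj₂ tree)
      F : Forest (Tight ℓ) (singleton zero) (proj₁ tree) f
      F = proj₂ (proj₂ tree)
      on-face : ∀ i → layerFace ℓ (xe (f i))
      on-face i = Q-xe (f i) , Equivalence.to (tight⇔level ℓ (f i)) (forest-edges F i)
      upper : ∀ p → (∀ i → layerFace ℓ (p i)) → ¬ AffIndep p
      upper p p∈F = Q-level-¬AffIndep (toℚ ℓ) 1≢0 p ℕP.≤-refl (proj₁ ∘ p∈F) (proj₂ ∘ p∈F)

    nonroot : ∀ (P : Fin (suc n0) → Bool) v → P v ≢ P zero → ∃ λ u → P (suc u) ≢ P zero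
    nonroot P zero    P0≢P0 = contradiction refl P0≢P0
    nonroot P (suc u) Pu≢P0 = u , Pu≢P0

    cut-separates-root : ∀ {C} P → IsCut C → C ≡ₑ cutOf P → ∃ λ u → P (suc u) ≢ P zero
    cut-separates-root P (_ , e , Ce) C≡P with P (tl e) Data.Bool.≟ P zero
    ... | no  Pt≢P0 = nonroot P (tl e) Pt≢P0
    ... | yes Pt≡P0 = nonroot P (hd e) λ Ph≡P0 → xor-true⇒≢ (trans (sym (C≡P e)) Ce) (trans Pt≡P0 (sym Ph≡P0))

    cutFace-rank : Connected → ∀ C P → Elementary C → DirectedShore C P → HasRank (cutFace P) n0
    cutFace-rank conn C P elem (C≡P , _) = lower , upper
      where
      u : Fin n0
      u = proj₁ (cut-separates-root P (proj₁ elem) C≡P)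
      Pu≢P0 : P (suc u) ≢ P zero
      Pu≢P0 = proj₂ (cut-separates-root P (proj₁ elem) C≡P)
      roots : Fin (suc n0) → Bool
      roots = insert (singleton zero) (suc u)
      size-roots : size roots ≡ 2
      size-roots = trans (size-insert (singleton zero) (suc u) (insert-other ∅ zero {suc u} λ ())) (cong suc (size-singleton zero))
      covered : ∀ v → ∃ λ w → roots w ≡ true × Reach (Uncut C) w v
      covered v with P v Data.Bool.≟ P zero
      ... | yes Pv≡P0 = zero , insert-mono (singleton zero) (suc u) {zero} (insert-self (∅ {suc n0}) zero) ,
                        shore-connected conn C P elem C≡P zero v (sym Pv≡P0)
      ... | no  Pv≢P0 = suc u , insert-self (singleton zero) (suc u) ,
                        shore-connected conn C P elem C≡P (suc u) v (≢-≢⇒≡ Pu≢P0 Pv≢P0)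
      uncut-on-face : ∀ e → Uncut C e → cutFace P (xe e)
      uncut-on-face e Ce = Q-xe e , dot-fvec-xe P e (xor-false⇒≡ (trans (sym (C≡P e)) Ce))
      lower : Σ (Fin n0 → Point (suc n0)) λ p → (∀ i → cutFace P (p i)) × AffIndep p
      lower with spanning-forest (λ e → C e Data.Bool.≟ false) roots covered
      ... | k , S , f , F , k+2≡N =
        subst (λ r → Σ (Fin r → Point (suc n0)) λ p → (∀ i → cutFace P (p i)) × AffIndep p)
              (ℕP.suc-injective (trans (trans (ℕP.+-comm 2 k) (cong (k ℕ.+_) (sym size-roots))) k+2≡N))
              (origin Vec.∷ (xe ∘ f) , (λ { zero → Q-origin , dot-origin (fvec P) ; (suc i) → uncut-on-face (f i) (forest-edges F i) }) ,
               LinIndep⇒AffIndep-∷origin (forest-LinIndep F))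
      upper : ∀ p → (∀ i → cutFace P (p i)) → ¬ AffIndep p
      upper p p∈F = two-sided-¬AffIndep p ℕP.≤-refl (side P zero) u (side-self P zero) (side-other P zero Pu≢P0)
                      (λ i → Q-ones (proj₁ (p∈F i))) (λ i → side-vanishing P zero (proj₁ (p∈F i)) (proj₂ (p∈F i)))

    cut-facet : Connected → ∀ C P → Elementary C → DirectedShore C P → IsFacet Q (cutFace P) × cutFace P origin
    cut-facet conn C P elem directed@(C≡P , toward-P) =
      (face , n0 , Q-rank conn , cutFace-rank conn C P elem directed) , Q-origin , dot-origin (fvec P)
      where
      -f : Point (suc n0)
      -f v = - fvec P v
      rises : ∀ e → 0ℚ ≤ fvec P (hd e) - fvec P (tl e)
      rises e with C e in Ce
      ... | true  rewrite toward-P e Ce with P (tl e)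
      ...   | true  = ℚP.≤-refl
      ...   | false = ℚP.≤ᵇ⇒≤ tt
      rises e | false = ℚP.≤-reflexive (sym (trans (sym (dot-xe (fvec P) e)) (dot-fvec-xe P e (xor-false⇒≡ (trans (sym (C≡P e)) Ce)))))
      valid : Valid -f 0ℚ
      valid = valid-on-gens -f 0ℚ λ
        { zero    → ℚP.≤-reflexive (dot-origin -f)
        ; (suc e) → ℚP.≤-trans (ℚP.≤-reflexive (trans (dot-negˡ (fvec P) (xe e)) (cong -_ (dot-xe (fvec P) e))))
                               (ℚP.neg-antimono-≤ (rises e)) }
      face : IsFace Q (cutFace P)
      face = -f , 0ℚ , valid , λ x →
        (λ (x∈Q , f·x≡0) → x∈Q , trans (dot-negˡ (fvec P) x) (cong -_ f·x≡0)) ,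
        (λ (x∈Q , -f·x≡0) → x∈Q , ℚP.neg-injective (trans (sym (dot-negˡ (fvec P) x)) -f·x≡0))

    layer-facet : Connected → ∀ ℓ → Admissible ℓ → IsFacet Q (layerFace ℓ) × ¬ layerFace ℓ origin
    layer-facet conn ℓ admissible@(slope≤1 , _) =
      (face , n0 , Q-rank conn , layerFace-rank ℓ admissible) , λ (_ , ℓ·0≡1) → 1≢0 (trans (sym ℓ·0≡1) (dot-origin (toℚ ℓ)))
      where
      valid : Valid (toℚ ℓ) 1ℚ
      valid = valid-on-gens (toℚ ℓ) 1ℚ λ
        { zero    → ℚP.≤-trans (ℚP.≤-reflexive (dot-origin (toℚ ℓ))) (ℚP.≤ᵇ⇒≤ tt)
        ; (suc e) → ℚP.≤-trans (ℚP.≤-reflexive (dot-ℓ-xe ℓ e)) (fromℤ-mono-≤ (slope≤1 e)) }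
      face : IsFace Q (layerFace ℓ)
      face = toℚ ℓ , 1ℚ , valid , λ x → id , id

    fvec-injective : ∀ (K : Fin (suc n0) → Bool) {u v} → fvec K u ≡ fvec K v → K u ≡ K v
    fvec-injective K {u} {v} eq with K u | K v
    ... | true  | true  = refl
    ... | false | false = refl
    ... | true  | false = contradiction eq 1≢0
    ... | false | true  = contradiction (sym eq) 1≢0

    xe∈cutFace⇔uncut : ∀ P e → cutFace P (xe e) ⇔ cutOf P e ≡ false
    xe∈cutFace⇔uncut P e = mk⇔
      (λ (_ , f·xe≡0) → trans (cong (_xor P (hd e)) (sym (fvec-injective P (p-q≡0⇒p≡q (trans (sym (dot-xe (fvec P) e)) f·xe≡0)))))
                               (BoolP.xor-same (P (hd e))))
      (λ uncut → Q-xe e , dot-fvec-xe P e (xor-false⇒≡ uncut))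

    cutFace-determines-cut : ∀ P P′ → cutFace P ≐ cutFace P′ → ∀ e → cutOf P e ≡ cutOf P′ e
    cutFace-determines-cut P P′ same e with cutOf P e in Pe | cutOf P′ e in P′e
    ... | true  | true  = refl
    ... | false | false = refl
    ... | false | true  = sym (trans (sym P′e) (Equivalence.to (xe∈cutFace⇔uncut P′ e)
                            (proj₁ (same (xe e)) (Equivalence.from (xe∈cutFace⇔uncut P e) Pe))))
    ... | true  | false = trans (sym Pe) (Equivalence.to (xe∈cutFace⇔uncut P e)
                            (proj₂ (same (xe e)) (Equivalence.from (xe∈cutFace⇔uncut P′ e) P′e)))

    -- Both head shores contain the head of a common cut edge, so they coincide.
    directed-shore-unique : Connected → ∀ {C P C′ P′} → IsCut C → DirectedShore C P → DirectedShore C′ P′ →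
                            C ≡ₑ C′ → ∀ v → P v ≡ P′ v
    directed-shore-unique conn {C} {P} {C′} {P′} (_ , e , Ce) (C≡P , toward-P) (C′≡P′ , toward-P′) C≡C′ v =
      xor-false⇒≡ (trans (same-cut⇒xor-constant conn P P′ same-cut (hd e) v)
                          (cong₂ _xor_ (toward-P e Ce) (toward-P′ e (trans (sym (C≡C′ e)) Ce))))
      where
      same-cut : ∀ e → cutOf P e ≡ cutOf P′ e
      same-cut e = trans (sym (C≡P e)) (trans (C≡C′ e) (C′≡P′ e))

    cut-correspondence-injective : Connected → ∀ C P C′ P′ →
                                   Elementary C → DirectedShore C P → Elementary C′ → DirectedShore C′ P′ →
                                   (cutFace P ≐ cutFace P′ → C ≡ₑ C′) × (C ≡ₑ C′ → cutFace P ≐ cutFace P′)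
    cut-correspondence-injective conn C P C′ P′ (C-cut , _) directed _ directed′ =
      (λ same e → trans (proj₁ directed e) (trans (cutFace-determines-cut P P′ same e) (sym (proj₁ directed′ e)))) ,
      (λ C≡C′ x → let P≡P′ = directed-shore-unique conn {C} {P} {C′} {P′} C-cut directed directed′ C≡C′ in
         (λ (x∈Q , f·x≡0) → x∈Q , trans (dot-congˡ x (λ v → sym (cong (λ b → if b then 1ℚ else 0ℚ) (P≡P′ v)))) f·x≡0) ,
         (λ (x∈Q , f·x≡0) → x∈Q , trans (dot-congˡ x (λ v → cong (λ b → if b then 1ℚ else 0ℚ) (P≡P′ v))) f·x≡0))

    layerFace-tight : ∀ ℓ ℓ′ → layerFace ℓ ≐ layerFace ℓ′ → ∀ e → Tight ℓ e → Tight ℓ′ e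
    layerFace-tight ℓ ℓ′ same e tight = Equivalence.from (tight⇔level ℓ′ e)
      (proj₂ (proj₁ (same (xe e)) (Q-xe e , Equivalence.to (tight⇔level ℓ e) tight)))

    layer-correspondence-injective : ∀ ℓ ℓ′ → Admissible ℓ → Admissible ℓ′ →
                                     (layerFace ℓ ≐ layerFace ℓ′ → ∃ λ (k : ℤ) → ∀ v → ℓ′ v ≡ ℓ v ℤ.+ k) ×
                                     ((∃ λ (k : ℤ) → ∀ v → ℓ′ v ≡ ℓ v ℤ.+ k) → layerFace ℓ ≐ layerFace ℓ′)
    layer-correspondence-injective ℓ ℓ′ (_ , tight-conn) _ = shift , unshift
      where
      shift : layerFace ℓ ≐ layerFace ℓ′ → ∃ λ (k : ℤ) → ∀ v → ℓ′ v ≡ ℓ v ℤ.+ k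
      shift same = difference zero , λ v → trans (Z.solve 2 (λ l l′ → l′ Z.:= l Z.:+ (l′ Z.:- l)) refl (ℓ v) (ℓ′ v))
                                                 (cong (λ d → ℓ v ℤ.+ d) (sym (reach-stable difference-stable (tight-conn zero v))))
        where
        difference : Fin (suc n0) → ℤ
        difference v = ℓ′ v ℤ.- ℓ v
        difference-stable : Stable (Tight ℓ) difference
        difference-stable e tight = sym (trans (cong₂ ℤ._-_ (layerFace-tight ℓ ℓ′ same e tight) tight)
          (Z.solve 2 (λ t t′ → (t′ Z.:+ Z.con (ℤ.+ 1)) Z.:- (t Z.:+ Z.con (ℤ.+ 1)) Z.:= t′ Z.:- t) refl (ℓ (tl e)) (ℓ′ (tl e))))
      unshift : (∃ λ (k : ℤ) → ∀ v → ℓ′ v ≡ ℓ v ℤ.+ k) → layerFace ℓ ≐ layerFace ℓ′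
      unshift (k , ℓ′≗) x = (λ (x∈Q , ℓ·x≡1) → x∈Q , trans (sym (same-value x∈Q)) ℓ·x≡1) ,
                            (λ (x∈Q , ℓ′·x≡1) → x∈Q , trans (same-value x∈Q) ℓ′·x≡1)
        where
        same-value : ∀ {x} → Q x → dot (toℚ ℓ) x ≡ dot (toℚ ℓ′) x
        same-value x∈Q = sym (trans (dot-affine-Q (fromℤ k) 1ℚ (toℚ ℓ′) (toℚ ℓ)
                           (λ v → trans (cong fromℤ (ℓ′≗ v)) (trans (fromℤ-+ (ℓ v) k)
                                    (S.solve 2 (λ l k → l S.:+ k S.:= k S.:+ S.con 1ℚ S.:* l) refl (fromℤ (ℓ v)) (fromℤ k)))) x∈Q)
                           (ℚP.*-identityˡ _))

    nonzero : ∀ {K : Fin (suc n0) → Bool} v → K zero ≡ true → K v ≡ false → ∃ λ u → v ≡ suc u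
    nonzero zero    K0 Kv = contradiction (trans (sym K0) Kv) λ ()
    nonzero (suc u) _  _  = u , refl

    module FacetStructure (conn : Connected) {F : PSet (suc n0)} (a : Point (suc n0)) (b : ℚ) (valid : Valid a b)
                          (F≐ : F ≐ (λ x → Q x × dot a x ≡ b)) {r : ℕ} (rankQ : HasRank Q (suc r)) (rankF : HasRank F r) where

      F→ : ∀ {x} → F x → Q x × dot a x ≡ b
      F→ {x} = proj₁ (F≐ x)

      F← : ∀ {x} → Q x → dot a x ≡ b → F x
      F← {x} x∈Q a·x≡b = proj₂ (F≐ x) (x∈Q , a·x≡b)

      OnFace : Fin m → Set
      OnFace e = dot a (xe e) ≡ b

      onFace? : ∀ e → Dec (OnFace e)
      onFace? e = dot a (xe e) ℚ.≟ b

      basis : Fin r → Point (suc n0)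
      basis = proj₁ (proj₁ rankF)

      basis∈F : ∀ i → F (basis i)
      basis∈F = proj₁ (proj₂ (proj₁ rankF))

      basis-indep : AffIndep basis
      basis-indep = proj₂ (proj₂ (proj₁ rankF))

      n0≤r : n0 ℕ.≤ r
      n0≤r = facet-rank≥ conn r rankQ

      Q⊈F : ¬ (∀ {x} → Q x → F x)
      Q⊈F Q⊆F = let p , p∈Q , indep = proj₁ rankQ in proj₂ rankF p (λ i → Q⊆F (p∈Q i)) indep

      side-vanishes-on-F : ∀ K → Stable OnFace K → ∀ u {x} → F x → dot (side K u) x ≡ 0ℚ
      side-vanishes-on-F K K-stable u x∈F =
        let x∈Q , a·x≡b = F→ x∈F
        in  side-vanishing K u x∈Q (face-vanishing a b valid x∈Q a·x≡b (fvec K) λ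
              { zero    _  → dot-origin (fvec K)
              ; (suc e) on → dot-fvec-xe K e (K-stable e on) })

      ones-vanish-on-F : ∀ {x} → F x → dot ones x ≡ 0ℚ
      ones-vanish-on-F = Q-ones ∘ proj₁ ∘ F→

      -- With b ≠ 0 the origin extends a basis of F to n affinely independent points, which a separation forbids.
      no-separation : b ≢ 0ℚ → ∀ w → ¬ Separated OnFace zero w
      no-separation b≢0 w (K , K0 , Kw , K-stable) =
        let u , Ku≢K0 = nonroot K w (labels-differ {K = K} K0 Kw)
        in  two-sided-¬AffIndep (origin Vec.∷ basis) n0≤r (side K zero) u (side-self K zero) (side-other K zero Ku≢K0)
              (λ { zero → dot-origin {suc n0} ones ; (suc i) → ones-vanish-on-F (basis∈F i) })
              (λ { zero → dot-origin (side K zero) ; (suc i) → side-vanishes-on-F K K-stable zero (basis∈F i) })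
              (LinIndep⇒AffIndep-∷origin {p = basis}
                (level-AffIndep⇒LinIndep a {p = basis} b≢0 (λ i → proj₂ (F→ (basis∈F i))) basis-indep))

      three-separated⇒⊥ : ∀ w v → Separated OnFace zero w → Separated OnFace zero v → Separated OnFace w v → ⊥
      three-separated⇒⊥ w v (K₁ , K₁0 , K₁w , st₁) (K₂ , K₂0 , K₂v , st₂) (K₃ , K₃w , K₃v , st₃)
        with nonzero {K₁} w K₁0 K₁w | nonzero {K₂} v K₂0 K₂v
      ... | w′ , refl | v′ , refl with K₁ (suc v′) in K₁v
      ...   | false = three-sided-¬AffIndep basis n0≤r w′ v′ w′≢v′ zero (suc w′) (suc v′) id
                        (side K₁ zero) (side K₃ (suc w′))
                        (side-self K₁ zero) (side-other K₁ zero (labels-differ {K = K₁} K₁0 K₁w))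
                        (side-other K₁ zero (labels-differ {K = K₁} K₁0 K₁v))
                        (side-self K₃ (suc w′)) (side-other K₃ (suc w′) (labels-differ {K = K₃} K₃w K₃v))
                        (ones-vanish-on-F ∘ basis∈F) (side-vanishes-on-F K₁ st₁ zero ∘ basis∈F)
                        (side-vanishes-on-F K₃ st₃ (suc w′) ∘ basis∈F) basis-indep
        where
        w′≢v′ : w′ ≢ v′
        w′≢v′ = ≢-sym (distinct-by-label {K = K₃ ∘ suc} K₃w K₃v)
      ...   | true  = three-sided-¬AffIndep basis n0≤r w′ v′ w′≢v′ (suc w′) zero (suc v′) reorder
                        (side K₁ (suc w′)) (side K₂ zero)
                        (side-self K₁ (suc w′)) (side-other K₁ (suc w′) (≢-sym (labels-differ {K = K₁} K₁0 K₁w)))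
                        (side-other K₁ (suc w′) (≢-sym (labels-differ {K = K₁} K₁v K₁w)))
                        (side-self K₂ zero) (side-other K₂ zero (labels-differ {K = K₂} K₂0 K₂v))
                        (ones-vanish-on-F ∘ basis∈F) (side-vanishes-on-F K₁ st₁ (suc w′) ∘ basis∈F)
                        (side-vanishes-on-F K₂ st₂ zero ∘ basis∈F) basis-indep
        where
        w′≢v′ : w′ ≢ v′
        w′≢v′ = ≢-sym (distinct-by-label {K = K₃ ∘ suc} K₃w K₃v)
        reorder : zero ∷ suc w′ ∷ suc v′ ∷ [] ⊆ suc w′ ∷ zero ∷ suc v′ ∷ []
        reorder (here refl)                 = there (here refl)
        reorder (there (here refl))         = here refl
        reorder (there (there (here refl))) = there (there (here refl))

      cancel-b : b ≢ 0ℚ → ∀ {y} → b * y ≡ b → y ≡ 1ℚ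
      cancel-b b≢0 {y} by≡b = p-q≡0⇒p≡q (*-cancel-≢0 b≢0 (begin
        b * (y - 1ℚ)  ≡⟨ S.solve 2 (λ b y → b S.:* (y S.:- S.con 1ℚ) S.:= b S.:* y S.:- b) refl b y ⟩
        b * y - b     ≡⟨ cong (_- b) by≡b ⟩
        b - b         ≡⟨ ℚP.+-inverseʳ b ⟩
        0ℚ            ∎))

      -- Along edges on F, a grows by exactly b, so a = a(0) + b ℓ for an integer layering ℓ.
      layering : b ≢ 0ℚ → Σ (Fin (suc n0) → ℤ) λ ℓ → Admissible ℓ × (F ≐ layerFace ℓ)
      layering b≢0 = ℓ , (slope≤1 , tight-connected) , F≐layerFace
        where
        on-face-step : ∀ e → OnFace e → a (hd e) ≡ a (tl e) + b
        on-face-step e on = trans (S.solve 2 (λ h t → h S.:= t S.:+ (h S.:- t)) refl (a (hd e)) (a (tl e)))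
                                  (cong (a (tl e) +_) (trans (sym (dot-xe a e)) on))
        reach-from-root : ∀ v → Reach OnFace zero v
        reach-from-root v with reach? onFace? zero v
        ... | inj₁ 0⇝v = 0⇝v
        ... | inj₂ sep = contradiction sep (no-separation b≢0 v)
        potential : ∀ v → ∃ λ z → a v ≡ a zero + fromℤ z * b
        potential v = reach-potential a b on-face-step (reach-from-root v)
        ℓ : Fin (suc n0) → ℤ
        ℓ v = proj₁ (potential v)
        a≡bℓ : ∀ {x} → Q x → dot a x ≡ b * dot (toℚ ℓ) x
        a≡bℓ = dot-affine-Q (a zero) b a (toℚ ℓ) λ v → trans (proj₂ (potential v)) (cong (a zero +_) (ℚP.*-comm (toℚ ℓ v) b))
        instance
          b-positive : ℚ.Positive b
          b-positive = ℚP.nonNeg∧nonZero⇒pos b {{ℚ.nonNegative 0≤b}} {{ℚ.≢-nonZero b≢0}}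
            where
            0≤b : 0ℚ ≤ b
            0≤b = ℚP.≤-trans (ℚP.≤-reflexive (sym (dot-origin a))) (valid origin Q-origin)
        slope≤1 : ∀ e → ℓ (hd e) ℤ.- ℓ (tl e) ℤ.≤ ℤ.+ 1
        slope≤1 e = fromℤ-cancel-≤ (ℚP.≤-trans (ℚP.≤-reflexive (sym (dot-ℓ-xe ℓ e))) (ℚP.*-cancelˡ-≤-pos b
          (ℚP.≤-trans (ℚP.≤-reflexive (sym (a≡bℓ (Q-xe e))))
            (ℚP.≤-trans (valid (xe e) (Q-xe e)) (ℚP.≤-reflexive (sym (ℚP.*-identityʳ b)))))))
        level→ : ∀ {x} → Q x → dot a x ≡ b → dot (toℚ ℓ) x ≡ 1ℚ
        level→ x∈Q a·x≡b = cancel-b b≢0 (trans (sym (a≡bℓ x∈Q)) a·x≡b)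
        level← : ∀ {x} → Q x → dot (toℚ ℓ) x ≡ 1ℚ → dot a x ≡ b
        level← x∈Q ℓ·x≡1 = trans (a≡bℓ x∈Q) (trans (cong (b *_) ℓ·x≡1) (ℚP.*-identityʳ b))
        on-face⇒tight : ∀ {e} → OnFace e → Tight ℓ e
        on-face⇒tight {e} on = Equivalence.from (tight⇔level ℓ e) (level→ (Q-xe e) on)
        tight-connected : SpanConnected (Tight ℓ)
        tight-connected u v = reach-trans (reach-sym (reach-mono on-face⇒tight (reach-from-root u)))
                                          (reach-mono on-face⇒tight (reach-from-root v))
        F≐layerFace : F ≐ layerFace ℓ
        F≐layerFace x = (λ x∈F → let x∈Q , a·x≡b = F→ x∈F in x∈Q , level→ x∈Q a·x≡b) ,
                        (λ (x∈Q , ℓ·x≡1) → F← x∈Q (level← x∈Q ℓ·x≡1))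

      a-stable : b ≡ 0ℚ → Stable OnFace a
      a-stable b≡0 e on = sym (p-q≡0⇒p≡q (trans (sym (dot-xe a e)) (trans on b≡0)))

      a-nonconstant : b ≡ 0ℚ → ∀ α → ¬ (∀ v → a v ≡ α)
      a-nonconstant b≡0 α a≡α = Q⊈F λ x∈Q → F← x∈Q (trans (vanishing-on-gens a a·gens≡0 x∈Q) (sym b≡0))
        where
        a·gens≡0 : ∀ j → dot a (gens j) ≡ 0ℚ
        a·gens≡0 zero    = dot-origin a
        a·gens≡0 (suc e) = trans (dot-xe a e) (trans (cong₂ _-_ (a≡α (hd e)) (a≡α (tl e))) (ℚP.+-inverseʳ α))

      -- For b = 0 the edges on F form exactly two components, those of 0 and of w.
      module TwoComponents (b≡0 : b ≡ 0ℚ) (w : Fin (suc n0)) (sep : Separated OnFace zero w) where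

        classes : ∀ v → Reach OnFace zero v ⊎ Reach OnFace w v
        classes v with reach? onFace? zero v | reach? onFace? w v
        ... | inj₁ 0⇝v | _        = inj₁ 0⇝v
        ... | inj₂ _   | inj₁ w⇝v = inj₂ w⇝v
        ... | inj₂ 0∤v | inj₂ w∤v = ⊥-elim (three-separated⇒⊥ w v sep 0∤v w∤v)

        class : Fin (suc n0) → Bool
        class v = [ (λ _ → true) , (λ _ → false) ]′ (classes v)

        via-class : ∀ {A : Set} (H : Fin (suc n0) → A) → Stable OnFace H → ∀ v → H v ≡ (if class v then H zero else H w)
        via-class H H-stable v with classes v
        ... | inj₁ 0⇝v = sym (reach-stable H-stable 0⇝v)
        ... | inj₂ w⇝v = sym (reach-stable H-stable w⇝v)

        0∤w : ¬ Reach OnFace zero w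
        0∤w 0⇝w = let K , K0 , Kw , K-stable = sep in
                  contradiction (trans (sym K0) (trans (reach-stable {K = K} K-stable 0⇝w) Kw)) λ ()

        class-stable : Stable OnFace class
        class-stable e on with classes (tl e) | classes (hd e)
        ... | inj₁ _   | inj₁ _   = refl
        ... | inj₂ _   | inj₂ _   = refl
        ... | inj₁ 0⇝t | inj₂ w⇝h = ⊥-elim (0∤w (reach-trans (fwd on 0⇝t) (reach-sym w⇝h)))
        ... | inj₂ w⇝t | inj₁ 0⇝h = ⊥-elim (0∤w (reach-trans (bwd on 0⇝h) (reach-sym w⇝t)))

        a0≢aw : a zero ≢ a w
        a0≢aw a0≡aw = a-nonconstant b≡0 (a zero) λ v → trans (via-class a (a-stable b≡0) v) (if-same (class v) (sym a0≡aw))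

        -- Any cut inside cutOf P separates the two components, hence equals cutOf P.
        minimal : ∀ P → Stable OnFace P → P zero ≢ P w → ∀ D → IsCut D → D ⊆ₑ cutOf P → D ≡ₑ cutOf P
        minimal P P-stable P0≢Pw D ((q , D≡q) , e₁ , De₁) D⊆P e = trans (D≡q e) (xor-constant⇒same-cut q P q⊕P e)
          where
          q-stable : Stable OnFace q
          q-stable e on with D e in De
          ... | true  = contradiction (trans (sym (D⊆P e De)) (trans (cong (_xor P (hd e)) (P-stable e on))
                                                                        (BoolP.xor-same (P (hd e))))) λ ()
          ... | false = xor-false⇒≡ (trans (sym (D≡q e)) De)
          q0≢qw : q zero ≢ q w
          q0≢qw q0≡qw = contradiction (trans (sym De₁) (trans (D≡q e₁) (trans (cong₂ _xor_ (q-const (tl e₁)) (q-const (hd e₁)))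
                                                                            (BoolP.xor-same (q zero))))) λ ()
            where
            q-const : ∀ v → q v ≡ q zero
            q-const v = trans (via-class q q-stable v) (if-same (class v) (sym q0≡qw))
          q⊕P : ∀ v → q v xor P v ≡ q zero xor P zero
          q⊕P v = trans (cong₂ _xor_ (via-class q q-stable v) (via-class P P-stable v)) (by-class (class v))
            where
            by-class : ∀ c → (if c then q zero else q w) xor (if c then P zero else P w) ≡ q zero xor P zero
            by-class true  = refl
            by-class false = xor-flip q0≢qw P0≢Pw

        cut-from-values : ∀ P → Stable OnFace P → ∀ A₀ A₁ → A₁ < A₀ → (∀ v → a v ≡ (if P v then A₁ else A₀)) →
                          Σ EdgeSet λ C → Σ (Fin (suc n0) → Bool) λ P → Elementary C × DirectedShore C P × (F ≐ cutFace P)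
        cut-from-values P P-stable A₀ A₁ A₁<A₀ a≗ =
          cutOf P , P , (is-cut , minimal P P-stable P0≢Pw) , ((λ e → refl) , toward-P) , F≐cutFace
          where
          P0≢Pw : P zero ≢ P w
          P0≢Pw P0≡Pw = a0≢aw (trans (a≗ zero) (trans (cong (λ c → if c then A₁ else A₀) P0≡Pw) (sym (a≗ w))))
          is-cut : IsCut (cutOf P)
          is-cut = (P , λ _ → refl) , let e , _ , Pt≢Ph = reach-crossing P (proj₂ conn zero w) P0≢Pw in e , xor-≢ Pt≢Ph
          toward-P : ∀ e → cutOf P e ≡ true → P (hd e) ≡ true
          toward-P e cut with P (tl e) in Pt | P (hd e) in Ph
          ... | _     | true  = refl
          ... | true  | false = ⊥-elim (ℚP.<-irrefl refl (ℚP.<-≤-trans A₁<A₀ (p-q≤0⇒p≤q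
                                  (ℚP.≤-trans (ℚP.≤-reflexive (sym rise))
                                    (ℚP.≤-trans (valid (xe e) (Q-xe e)) (ℚP.≤-reflexive b≡0))))))
            where
            rise : dot a (xe e) ≡ A₀ - A₁
            rise = trans (dot-xe a e) (cong₂ _-_ (trans (a≗ (hd e)) (cong (λ c → if c then A₁ else A₀) Ph))
                                                 (trans (a≗ (tl e)) (cong (λ c → if c then A₁ else A₀) Pt)))
          two-values : ∀ c → (if c then A₁ else A₀) ≡ A₀ + (A₁ - A₀) * (if c then 1ℚ else 0ℚ)
          two-values true  = S.solve 2 (λ A₀ A₁ → A₁ S.:= A₀ S.:+ (A₁ S.:- A₀) S.:* S.con 1ℚ) refl A₀ A₁
          two-values false = S.solve 2 (λ A₀ A₁ → A₀ S.:= A₀ S.:+ (A₁ S.:- A₀) S.:* S.con 0ℚ) refl A₀ A₁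
          a≡Δf : ∀ {x} → Q x → dot a x ≡ (A₁ - A₀) * dot (fvec P) x
          a≡Δf = dot-affine-Q A₀ (A₁ - A₀) a (fvec P) λ v → trans (a≗ v) (two-values (P v))
          Δ≢0 : A₁ - A₀ ≢ 0ℚ
          Δ≢0 Δ≡0 = ℚP.<-irrefl (p-q≡0⇒p≡q Δ≡0) A₁<A₀
          F≐cutFace : F ≐ cutFace P
          F≐cutFace x =
            (λ x∈F → let x∈Q , a·x≡b = F→ x∈F in x∈Q , *-cancel-≢0 Δ≢0 (trans (sym (a≡Δf x∈Q)) (trans a·x≡b b≡0))) ,
            (λ (x∈Q , f·x≡0) → F← x∈Q (trans (a≡Δf x∈Q)
                                   (trans (cong ((A₁ - A₀) *_) f·x≡0) (trans (ℚP.*-zeroʳ (A₁ - A₀)) (sym b≡0)))))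

        -- The head shore V₁ is the component where a is smaller.
        cut : Σ EdgeSet λ C → Σ (Fin (suc n0) → Bool) λ P → Elementary C × DirectedShore C P × (F ≐ cutFace P)
        cut with ℚP.<-cmp (a zero) (a w)
        ... | tri< a0<aw _ _ = cut-from-values class class-stable (a w) (a zero) a0<aw (via-class a (a-stable b≡0))
        ... | tri≈ _ a0≡aw _ = contradiction a0≡aw a0≢aw
        ... | tri> _ _ aw<a0 = cut-from-values (not ∘ class) (λ e on → cong not (class-stable e on)) (a zero) (a w) aw<a0
                                 λ v → trans (via-class a (a-stable b≡0) v) (sym (BoolP.if-not (class v)))

      cut-structure : b ≡ 0ℚ → Σ EdgeSet λ C → Σ (Fin (suc n0) → Bool) λ P → Elementary C × DirectedShore C P × (F ≐ cutFace P)
      cut-structure b≡0 with connected-or-separated onFace? zero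
      ... | inj₁ 0⇝all     = ⊥-elim (a-nonconstant b≡0 (a zero) λ v → sym (reach-stable (a-stable b≡0) (0⇝all v)))
      ... | inj₂ (w , sep) = TwoComponents.cut b≡0 w sep

    facet∋origin⇒cut : Connected → ∀ (F : PSet (suc n0)) → IsFacet Q F → F origin →
                       Σ EdgeSet λ C → Σ (Fin (suc n0) → Bool) λ P → Elementary C × DirectedShore C P × (F ≐ cutFace P)
    facet∋origin⇒cut conn F ((a , b , valid , F≐) , r , rankQ , rankF) F∋0 =
      cut-structure (trans (sym (proj₂ (F→ F∋0))) (dot-origin a))
      where open FacetStructure conn a b valid F≐ rankQ rankF

    facet∌origin⇒layering : Connected → ∀ (F : PSet (suc n0)) → IsFacet Q F → ¬ F origin →
                            Σ (Fin (suc n0) → ℤ) λ ℓ → Admissible ℓ × (F ≐ layerFace ℓ)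
    facet∌origin⇒layering conn F ((a , b , valid , F≐) , r , rankQ , rankF) F∌0 =
      layering λ b≡0 → F∌0 (F← Q-origin (trans (dot-origin a) (sym b≡0)))
      where open FacetStructure conn a b valid F≐ rankQ rankF

open import Data.Nat using (ℕ; zero; suc)
open import Data.Integer using (ℤ; _+_)
open import Data.Fin using (Fin)
open import Data.Bool using (Bool)
open import Data.Product using (Σ; ∃; _×_; _,_)
open import Relation.Nullary using (¬_)
open import Relation.Binary.PropositionalEquality using (_≡_)

corollary2p11 : (n m : ℕ) (tl hd : Fin m → Fin n) → let open Graph tl hd in
    Connected →
    -- (1) elementary directed cuts ↔ facets containing 0
    ( (∀ C p → Elementary C → DirectedShore C p → IsFacet Q (cutFace p) × cutFace p origin)
    × (∀ C p C′ p′ → Elementary C → DirectedShore C p → Elementary C′ → DirectedShore C′ p′ →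
         (cutFace p ≐ cutFace p′ → C ≡ₑ C′) × (C ≡ₑ C′ → cutFace p ≐ cutFace p′))
    × (∀ (F : PSet n) → IsFacet Q F → F origin →
         Σ EdgeSet λ C → Σ (Fin n → Bool) λ p → Elementary C × DirectedShore C p × (F ≐ cutFace p)) )
    ×
    -- (2) admissible layerings modulo ℓ ∼ ℓ + m𝟏 ↔ facets not containing 0
    ( (∀ ℓ → Admissible ℓ → IsFacet Q (layerFace ℓ) × ¬ layerFace ℓ origin)
    × (∀ ℓ ℓ′ → Admissible ℓ → Admissible ℓ′ →
         (layerFace ℓ ≐ layerFace ℓ′ → ∃ λ (k : ℤ) → ∀ v → ℓ′ v ≡ ℓ v + k)
         × ((∃ λ (k : ℤ) → ∀ v → ℓ′ v ≡ ℓ v + k) → layerFace ℓ ≐ layerFace ℓ′))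
    × (∀ (F : PSet n) → IsFacet Q F → ¬ F origin →
         Σ (Fin n → ℤ) λ ℓ → Admissible ℓ × (F ≐ layerFace ℓ)) )
corollary2p11 zero     m tl hd (() , _)
corollary2p11 (suc n0) m tl hd conn =
  (cut-facet conn , cut-correspondence-injective conn , facet∋origin⇒cut conn) ,
  (layer-facet conn , layer-correspondence-injective , facet∌origin⇒layering conn)
  where open Proof.Facets tl hd
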